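{- Let $a\ge 1$ be an odd integer. Then $$ \lim_{n\to \infty}\frac{\#\{1\le k\le n\mid\mathrm{cp}_{a,a,2a}(k) \text{ is even}\}}{n}=1.$$ Moreover, for a nonnegative integer $k$, $\mathrm{cp}_{a,a,2a}(k)$ is odd if and only if $k=2an(3n-1)$ for some integer $n$.
   Context: For integers $a,b,m\ge1$, an $(a,b,m)$-copartition is a triple of integer partitions $(\gamma,\rho,\sigma)$ such that every part of $\gamma$ is $\ge a$ and $\equiv a \pmod m$, every part of $\sigma$ is $\ge b$ and $\equiv b\pmod m$, and $\rho$ has exactly as many parts as $\sigma$, each part of $\rho$ being equal to $m$ times the number of parts of $\gamma$. Its size is the sum of all parts of $\gamma,\rho,\sigma$, and $\mathrm{cp}_{a,b,m}(n)$ denotes the number of $(a,b,m)$-copartitions of size $n$. -}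

module Defs where

open import Data.Nat using (ℕ; zero; suc; _+_; _*_; _∸_; _≤_; _≤?_)
open import Data.Nat.Divisibility using (_∣_; _∣?_)
open import Data.Nat.Properties using (_≟_)
open import Data.List using (List; []; _∷_; map; concatMap; filter; upTo; length; replicate)
open import Data.Nat.ListAction using (sum)
open import Data.List.Relation.Unary.All using (All; all?)
open import Data.Product using (_×_; _,_)
open import Relation.Nullary.Decidable using (Dec; _×-dec_; ¬?)
open import Relation.Binary.PropositionalEquality using (_≡_)

-- Integer partitions, represented as non-increasing lists of positive
-- naturals.  partsLe f n k enumerates all partitions of n whose parts
-- are all ≤ k (f is fuel, f ≥ n suffices); each partition appears once.

partsLe : ℕ → ℕ → ℕ → List (List ℕ)
partsLe _       zero    _ = [] ∷ []
partsLe zero    (suc n) _ = []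
partsLe (suc f) (suc n) k =
  concatMap (λ p → map (p ∷_) (partsLe f (suc n ∸ p) p))
            (filter (_≤? k) (map suc (upTo (suc n))))

partitions : ℕ → List (List ℕ)
partitions n = partsLe n n n

PartOk : ℕ → ℕ → ℕ → Set
PartOk a m x = (a ≤ x) × (m ∣ (x ∸ a))

partOk? : (a m x : ℕ) → Dec (PartOk a m x)
partOk? a m x = (a ≤? x) ×-dec (m ∣? (x ∸ a))

AllPartsOk : ℕ → ℕ → List ℕ → Set
AllPartsOk a m = All (PartOk a m)

allPartsOk? : (a m : ℕ) (λs : List ℕ) → Dec (AllPartsOk a m λs)
allPartsOk? a m = all? (partOk? a m)

Copartition : Set
Copartition = List ℕ × List ℕ × List ℕ

size : Copartition → ℕ
size (γ , ρ , σ) = sum γ + sum ρ + sum σ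

-- All (a,b,m)-copartitions of size n.  γ ranges over partitions of i ≤ n
-- with parts ≥ a, ≡ a (mod m); σ over partitions of j ≤ n with
-- parts ≥ b, ≡ b (mod m); ρ is forced: (length σ) parts, each equal to
-- m * (length γ).
copartitions : ℕ → ℕ → ℕ → ℕ → List Copartition
copartitions a b m n =
  filter (λ c → size c ≟ n)
    (concatMap (λ i →
     concatMap (λ j →
       concatMap (λ γ →
         map (λ σ → (γ , replicate (length σ) (m * length γ) , σ))
             (filter (allPartsOk? b m) (partitions j)))
         (filter (allPartsOk? a m) (partitions i)))
       (upTo (suc n)))
     (upTo (suc n)))

cp : ℕ → ℕ → ℕ → ℕ → ℕ
cp a b m n = length (copartitions a b m n)

evenCount : ℕ → ℕ → ℕ
evenCount a n = length (filter (λ k → 2 ∣? cp a a (2 * a) k) (map suc (upTo n)))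

{-# OPTIONS --safe #-}
module Submission where

-- Swapping γ and σ is an involution on (a,a,m)-copartitions, so mod 2 only its fixed points
-- (γ , ρ , γ) count.  Writing the ℓ parts of γ as a + m vᵢ with m = 2a, such a fixed point has
-- size 2m (T ℓ + Σ vᵢ), T ℓ the ℓ-th triangular number, and adding the staircase ℓ, …, 1 to the
-- partition (vᵢ) gives a partition of K = T ℓ + Σ vᵢ into ℓ distinct parts.  So cp(k) is odd iff
-- k = 2m K with an odd number of partitions of K into distinct parts, which by Euler's pentagonal
-- theorem mod 2 means K = z (3z − 1)/2, i.e. k = 2a z (3z − 1).  Below n there are at most 2√n
-- such k, whence the density.

open import Defs
open import Data.Nat using (ℕ; zero; suc; _+_; _*_; _∸_; _≤_; _<_; z≤n; s≤s; z<s; s<s; _≤?_; _<?_; _≡ᵇ_; _≤ᵇ_; _<ᵇ_; NonZero; >-nonZero; >-nonZero⁻¹; ≢-nonZero⁻¹)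
open import Data.Nat.Properties
open import Data.Nat.Divisibility using (_∣_; divides; _∣?_)
open import Data.Integer using (ℤ; +_; -[1+_])
import Data.Integer as ℤ
import Data.Integer.Properties as ℤₚ
open import Data.Integer.Solver using () renaming (module +-*-Solver to ℤ-Solver)
open import Data.Bool using (Bool; true; false; _∧_; not) renaming (_xor_ to _⊕_)
open import Data.Bool.Properties
  using (xor-assoc; xor-comm; xor-same; xor-identityʳ; ∧-distribˡ-xor; ∧-distribʳ-xor;
         ∧-assoc; ∧-comm; ∧-zeroʳ; ∧-identityʳ; not-involutive; ¬-not; xor-∧-commutativeRing)
open import Data.List using (List; []; _∷_; map; concatMap; concat; filter; upTo; applyUpTo; length; replicate; _++_)
open import Data.Nat.ListAction using (sum)
open import Data.List.Properties using (map-applyUpTo)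
open import Data.List.Relation.Unary.All using (all?)
open import Data.Product using (_×_; _,_; ∃)
open import Data.Sum using (_⊎_; inj₁; inj₂)
open import Data.Empty using (⊥-elim)
open import Function using (_∘_)
open import Function.Bundles using (_⇔_; mk⇔; Equivalence)
import Function.Properties.Equivalence as ⇔
open import Data.Nat.Solver using (module +-*-Solver)
open import Relation.Nullary using (¬_; Dec; yes; no; does; _×-dec_)
open import Relation.Nullary.Decidable using (dec-true; dec-false; does-⇔)
open import Relation.Binary.PropositionalEquality
open import Algebra.Bundles using (CommutativeRing)
import Algebra.Properties.CommutativeSemigroup as CommSemigroupProperties

module ⊕ = CommSemigroupProperties (CommutativeRing.+-commutativeSemigroup xor-∧-commutativeRing)
module ∧ = CommSemigroupProperties (CommutativeRing.*-commutativeSemigroup xor-∧-commutativeRing)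

-- Sums over 𝔽₂

xorSum : ℕ → (ℕ → Bool) → Bool
xorSum zero    f = false
xorSum (suc n) f = f 0 ⊕ xorSum n (f ∘ suc)

xorSum-cong : ∀ n {f g : ℕ → Bool} → (∀ i → i < n → f i ≡ g i) → xorSum n f ≡ xorSum n g
xorSum-cong zero    eq = refl
xorSum-cong (suc n) eq = cong₂ _⊕_ (eq 0 z<s) (xorSum-cong n (λ i i<n → eq (suc i) (s<s i<n)))

xorSum-false : ∀ n {f : ℕ → Bool} → (∀ i → i < n → f i ≡ false) → xorSum n f ≡ false
xorSum-false zero    eq = refl
xorSum-false (suc n) eq rewrite eq 0 z<s = xorSum-false n (λ i i<n → eq (suc i) (s<s i<n))

xorSum-⊕ : ∀ n (f g : ℕ → Bool) → xorSum n (λ i → f i ⊕ g i) ≡ xorSum n f ⊕ xorSum n g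
xorSum-⊕ zero    f g = refl
xorSum-⊕ (suc n) f g = trans (cong ((f 0 ⊕ g 0) ⊕_) (xorSum-⊕ n (f ∘ suc) (g ∘ suc))) (⊕.interchange (f 0) (g 0) _ _)

∧-distribˡ-xorSum : ∀ n b (f : ℕ → Bool) → b ∧ xorSum n f ≡ xorSum n (λ i → b ∧ f i)
∧-distribˡ-xorSum zero    b f = ∧-zeroʳ b
∧-distribˡ-xorSum (suc n) b f = trans (∧-distribˡ-xor b (f 0) _) (cong ((b ∧ f 0) ⊕_) (∧-distribˡ-xorSum n b (f ∘ suc)))

∧-distribʳ-xorSum : ∀ n b (f : ℕ → Bool) → xorSum n f ∧ b ≡ xorSum n (λ i → f i ∧ b)
∧-distribʳ-xorSum n b f =
  trans (∧-comm (xorSum n f) b) (trans (∧-distribˡ-xorSum n b f) (xorSum-cong n (λ i _ → ∧-comm b (f i))))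

xorSum-+ : ∀ m n (f : ℕ → Bool) → xorSum (m + n) f ≡ xorSum m f ⊕ xorSum n (λ i → f (m + i))
xorSum-+ zero    n f = refl
xorSum-+ (suc m) n f = trans (cong (f 0 ⊕_) (xorSum-+ m n (f ∘ suc))) (sym (xor-assoc (f 0) _ _))

xorSum-sucʳ : ∀ n (f : ℕ → Bool) → xorSum (suc n) f ≡ xorSum n f ⊕ f n
xorSum-sucʳ n f = begin
  xorSum (suc n) f                     ≡⟨ cong (λ k → xorSum k f) (+-comm 1 n) ⟩
  xorSum (n + 1) f                     ≡⟨ xorSum-+ n 1 f ⟩
  xorSum n f ⊕ (f (n + 0) ⊕ false)     ≡⟨ cong (λ b → xorSum n f ⊕ b) (trans (xor-identityʳ _) (cong f (+-identityʳ n))) ⟩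
  xorSum n f ⊕ f n                     ∎
  where open ≡-Reasoning

xorSum-extend : ∀ {m n} (f : ℕ → Bool) → m ≤ n → (∀ i → m ≤ i → i < n → f i ≡ false) → xorSum m f ≡ xorSum n f
xorSum-extend {m} {n} f m≤n vanish = begin
  xorSum m f                                   ≡⟨ sym (xor-identityʳ _) ⟩
  xorSum m f ⊕ false                           ≡⟨ cong (xorSum m f ⊕_) (sym (xorSum-false (n ∸ m) tail)) ⟩
  xorSum m f ⊕ xorSum (n ∸ m) (λ i → f (m + i)) ≡⟨ sym (xorSum-+ m (n ∸ m) f) ⟩
  xorSum (m + (n ∸ m)) f                       ≡⟨ cong (λ k → xorSum k f) (m+[n∸m]≡n m≤n) ⟩
  xorSum n f                                   ∎
  where
  open ≡-Reasoning
  tail : ∀ i → i < n ∸ m → f (m + i) ≡ false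
  tail i i<n∸m = vanish (m + i) (m≤m+n m i) (subst (m + i <_) (m+[n∸m]≡n m≤n) (+-monoʳ-< m i<n∸m))

xorSum-swap : ∀ m n (f : ℕ → ℕ → Bool) →
              xorSum m (λ i → xorSum n (f i)) ≡ xorSum n (λ j → xorSum m (λ i → f i j))
xorSum-swap zero    n f = sym (xorSum-false n (λ _ _ → refl))
xorSum-swap (suc m) n f = trans (cong (xorSum n (f 0) ⊕_) (xorSum-swap m n (f ∘ suc)))
                                (sym (xorSum-⊕ n (f 0) (λ j → xorSum m (λ i → f (suc i) j))))

xorSum-indicator : ∀ n c (f : ℕ → Bool) → xorSum n (λ i → (i ≡ᵇ c) ∧ f i) ≡ (c <ᵇ n) ∧ f c
xorSum-indicator zero    c       f = refl
xorSum-indicator (suc n) zero    f = trans (cong (f 0 ⊕_) (xorSum-false n (λ _ _ → refl))) (xor-identityʳ (f 0))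
xorSum-indicator (suc n) (suc c) f = xorSum-indicator n c (f ∘ suc)

⊕-cancelˡ : ∀ a c → a ⊕ (a ⊕ c) ≡ c
⊕-cancelˡ a c = trans (sym (xor-assoc a a c)) (cong (_⊕ c) (xor-same a))

⊕-transpose : ∀ {a b c} → a ⊕ b ≡ c → a ≡ c ⊕ b
⊕-transpose {a} {b} refl = sym (trans (xor-assoc a b b) (trans (cong (a ⊕_) (xor-same b)) (xor-identityʳ a)))

⊕-cancel-middle : ∀ a r d → (a ⊕ r) ⊕ (r ⊕ d) ≡ a ⊕ d
⊕-cancel-middle a r d = trans (xor-assoc a r (r ⊕ d)) (cong (a ⊕_) (⊕-cancelˡ r d))

private variable
  A B : Set

xorList : (A → Bool) → List A → Bool
xorList f []       = false
xorList f (x ∷ xs) = f x ⊕ xorList f xs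

xorList-cong : ∀ {f g : A → Bool} xs → (∀ x → f x ≡ g x) → xorList f xs ≡ xorList g xs
xorList-cong []       eq = refl
xorList-cong (x ∷ xs) eq = cong₂ _⊕_ (eq x) (xorList-cong xs eq)

xorList-false : ∀ (xs : List A) → xorList (λ _ → false) xs ≡ false
xorList-false []       = refl
xorList-false (x ∷ xs) = xorList-false xs

xorList-⊕ : ∀ (f g : A → Bool) xs → xorList (λ x → f x ⊕ g x) xs ≡ xorList f xs ⊕ xorList g xs
xorList-⊕ f g []       = refl
xorList-⊕ f g (x ∷ xs) = trans (cong ((f x ⊕ g x) ⊕_) (xorList-⊕ f g xs)) (⊕.interchange (f x) (g x) _ _)

xorList-++ : ∀ (f : A → Bool) xs ys → xorList f (xs ++ ys) ≡ xorList f xs ⊕ xorList f ys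
xorList-++ f []       ys = refl
xorList-++ f (x ∷ xs) ys = trans (cong (f x ⊕_) (xorList-++ f xs ys)) (sym (xor-assoc (f x) _ _))

∧-distribˡ-xorList : ∀ b (f : A → Bool) xs → b ∧ xorList f xs ≡ xorList (λ x → b ∧ f x) xs
∧-distribˡ-xorList b f []       = ∧-zeroʳ b
∧-distribˡ-xorList b f (x ∷ xs) = trans (∧-distribˡ-xor b (f x) _) (cong ((b ∧ f x) ⊕_) (∧-distribˡ-xorList b f xs))

xorList-filter : ∀ {P : A → Set} (P? : ∀ x → Dec (P x)) (f : A → Bool) xs →
                 xorList f (filter P? xs) ≡ xorList (λ x → does (P? x) ∧ f x) xs
xorList-filter P? f [] = refl
xorList-filter P? f (x ∷ xs) with P? x
... | yes _ = cong (f x ⊕_) (xorList-filter P? f xs)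
... | no  _ = xorList-filter P? f xs

xorList-swap : ∀ (f : A → B → Bool) xs ys →
               xorList (λ x → xorList (f x) ys) xs ≡ xorList (λ y → xorList (λ x → f x y) xs) ys
xorList-swap f []       ys = sym (xorList-false ys)
xorList-swap f (x ∷ xs) ys = trans (cong (xorList (f x) ys ⊕_) (xorList-swap f xs ys))
                                   (sym (xorList-⊕ (f x) (λ y → xorList (λ x → f x y) xs) ys))

-- The off-diagonal terms f x y and f y x cancel in pairs.
xorList-symmetric : ∀ (f : A → A → Bool) → (∀ x y → f x y ≡ f y x) → ∀ xs →
                    xorList (λ x → xorList (f x) xs) xs ≡ xorList (λ x → f x x) xs
xorList-symmetric f f-sym []       = refl
xorList-symmetric f f-sym (z ∷ xs) = begin
  (f z z ⊕ xorList (f z) xs) ⊕ xorList (λ x → f x z ⊕ xorList (f x) xs) xs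
    ≡⟨ cong ((f z z ⊕ xorList (f z) xs) ⊕_) (xorList-⊕ (λ x → f x z) (λ x → xorList (f x) xs) xs) ⟩
  (f z z ⊕ xorList (f z) xs) ⊕ (xorList (λ x → f x z) xs ⊕ offDiagonal)
    ≡⟨ cong (λ b → (f z z ⊕ xorList (f z) xs) ⊕ (b ⊕ offDiagonal)) (xorList-cong xs (λ x → f-sym x z)) ⟩
  (f z z ⊕ xorList (f z) xs) ⊕ (xorList (f z) xs ⊕ offDiagonal)
    ≡⟨ ⊕-cancel-middle (f z z) (xorList (f z) xs) offDiagonal ⟩
  f z z ⊕ offDiagonal
    ≡⟨ cong (f z z ⊕_) (xorList-symmetric f f-sym xs) ⟩
  f z z ⊕ xorList (λ x → f x x) xs ∎
  where
  open ≡-Reasoning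
  offDiagonal : Bool
  offDiagonal = xorList (λ x → xorList (f x) xs) xs

xorList-map : ∀ (f : B → Bool) (g : A → B) xs → xorList f (map g xs) ≡ xorList (f ∘ g) xs
xorList-map f g []       = refl
xorList-map f g (x ∷ xs) = cong (f (g x) ⊕_) (xorList-map f g xs)

xorList-concatMap : ∀ (f : B → Bool) (g : A → List B) xs →
                    xorList f (concatMap g xs) ≡ xorList (λ x → xorList f (g x)) xs
xorList-concatMap f g []       = refl
xorList-concatMap f g (x ∷ xs) =
  trans (xorList-++ f (g x) (concat (map g xs))) (cong (xorList f (g x) ⊕_) (xorList-concatMap f g xs))

xorList-applyUpTo : ∀ (f : ℕ → Bool) (g : ℕ → ℕ) n → xorList f (applyUpTo g n) ≡ xorSum n (f ∘ g)
xorList-applyUpTo f g zero    = refl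
xorList-applyUpTo f g (suc n) = cong (f (g 0) ⊕_) (xorList-applyUpTo f (g ∘ suc) n)

xorList-upTo : ∀ (f : ℕ → Bool) n → xorList f (upTo n) ≡ xorSum n f
xorList-upTo f = xorList-applyUpTo f (λ i → i)

odd : ℕ → Bool
odd zero    = false
odd (suc n) = not (odd n)

odd-length-filter : ∀ {P : A → Set} (P? : ∀ x → Dec (P x)) xs →
                    odd (length (filter P? xs)) ≡ xorList (does ∘ P?) xs
odd-length-filter P? [] = refl
odd-length-filter P? (x ∷ xs) with P? x
... | yes _ = cong not (odd-length-filter P? xs)
... | no  _ = odd-length-filter P? xs

does-sound : ∀ {P : Set} (P? : Dec P) → does P? ≡ true → P
does-sound (yes p) _ = p

≡ᵇ-true : ∀ {m n} → m ≡ n → (m ≡ᵇ n) ≡ true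
≡ᵇ-true {m} {n} = dec-true (m ≟ n)

≡ᵇ-false : ∀ {m n} → m ≢ n → (m ≡ᵇ n) ≡ false
≡ᵇ-false {m} {n} = dec-false (m ≟ n)

≡ᵇ-sound : ∀ {m n} → (m ≡ᵇ n) ≡ true → m ≡ n
≡ᵇ-sound {m} {n} = does-sound (m ≟ n)

≤ᵇ-true : ∀ {m n} → m ≤ n → (m ≤ᵇ n) ≡ true
≤ᵇ-true {m} {n} = dec-true (m ≤? n)

≤ᵇ-false : ∀ {m n} → ¬ m ≤ n → (m ≤ᵇ n) ≡ false
≤ᵇ-false {m} {n} = dec-false (m ≤? n)

≤ᵇ-sound : ∀ {m n} → (m ≤ᵇ n) ≡ true → m ≤ n
≤ᵇ-sound {m} {n} = does-sound (m ≤? n)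

≤ᵇ-suc : ∀ v M → (v ≤ᵇ suc M) ≡ (v ≤ᵇ M) ⊕ (v ≡ᵇ suc M)
≤ᵇ-suc v M with v ≤? M | v ≟ suc M
... | yes v≤M | _ = trans (≤ᵇ-true (m≤n⇒m≤1+n v≤M))
                          (sym (cong₂ _⊕_ (≤ᵇ-true v≤M) (≡ᵇ-false (λ v≡1+M → 1+n≰n (subst (_≤ M) v≡1+M v≤M)))))
... | no v≰M | yes v≡1+M = trans (≤ᵇ-true (≤-reflexive v≡1+M)) (sym (cong₂ _⊕_ (≤ᵇ-false v≰M) (≡ᵇ-true v≡1+M)))
... | no v≰M | no v≢1+M  = trans (≤ᵇ-false (λ v≤1+M → v≢1+M (≤∧≮⇒≡ v≤1+M (λ v<1+M → v≰M (≤-pred v<1+M)))))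
                                 (sym (cong₂ _⊕_ (≤ᵇ-false v≰M) (≡ᵇ-false v≢1+M)))

≡ᵇ-∧-subst : ∀ u w (f : ℕ → Bool) → (u ≡ᵇ w) ∧ f u ≡ (u ≡ᵇ w) ∧ f w
≡ᵇ-∧-subst u w f with u ≟ w
... | yes refl = refl
... | no  u≢w  rewrite ≡ᵇ-false u≢w = refl

≡ᵇ-+ : ∀ n c x → (n ≡ᵇ c + x) ≡ (c ≤ᵇ n) ∧ (n ∸ c ≡ᵇ x)
≡ᵇ-+ n c x with c ≤? n
... | no  c≰n rewrite ≤ᵇ-false c≰n = ≡ᵇ-false (λ n≡c+x → c≰n (subst (c ≤_) (sym n≡c+x) (m≤m+n c x)))
... | yes c≤n rewrite ≤ᵇ-true c≤n =
  does-⇔ (mk⇔ (λ n≡c+x → trans (cong (_∸ c) n≡c+x) (m+n∸m≡n c x))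
              (λ n∸c≡x → trans (sym (m+[n∸m]≡n c≤n)) (cong (λ u → c + u) n∸c≡x)))
         (n ≟ c + x) (n ∸ c ≟ x)

<ᵇ-suc : ∀ c n → (c <ᵇ suc n) ≡ (c ≤ᵇ n)
<ᵇ-suc c n = does-⇔ (mk⇔ ≤-pred s≤s) (c <? suc n) (c ≤? n)

xorSum-swap-∧ : ∀ m n (a b : ℕ → Bool) (c : ℕ → ℕ → Bool) →
                xorSum m (λ i → a i ∧ xorSum n (λ j → b j ∧ c i j)) ≡ xorSum n (λ j → b j ∧ xorSum m (λ i → a i ∧ c i j))
xorSum-swap-∧ m n a b c = begin
  xorSum m (λ i → a i ∧ xorSum n (λ j → b j ∧ c i j))
    ≡⟨ xorSum-cong m (λ i _ → ∧-distribˡ-xorSum n (a i) (λ j → b j ∧ c i j)) ⟩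
  xorSum m (λ i → xorSum n (λ j → a i ∧ (b j ∧ c i j)))
    ≡⟨ xorSum-swap m n (λ i j → a i ∧ (b j ∧ c i j)) ⟩
  xorSum n (λ j → xorSum m (λ i → a i ∧ (b j ∧ c i j)))
    ≡⟨ xorSum-cong n (λ j _ → xorSum-cong m (λ i _ → ∧.x∙yz≈y∙xz (a i) (b j) (c i j))) ⟩
  xorSum n (λ j → xorSum m (λ i → b j ∧ (a i ∧ c i j)))
    ≡⟨ xorSum-cong n (λ j _ → sym (∧-distribˡ-xorSum m (b j) (λ i → a i ∧ c i j))) ⟩
  xorSum n (λ j → b j ∧ xorSum m (λ i → a i ∧ c i j)) ∎
  where open ≡-Reasoning

-- Change of variables q = g v, for a predicate P whose indicator counts the preimages under g.
xorSum-reindex : ∀ n B (P w : ℕ → Bool) (g : ℕ → ℕ) → (∀ q → q ≤ n → P q ≡ xorSum B (λ v → q ≡ᵇ g v)) →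
                 xorSum (suc n) (λ q → P q ∧ w q) ≡ xorSum B (λ v → (g v ≤ᵇ n) ∧ w (g v))
xorSum-reindex n B P w g P≡ = begin
  xorSum (suc n) (λ q → P q ∧ w q)
    ≡⟨ xorSum-cong (suc n) (λ q q<1+n → trans (cong (_∧ w q) (P≡ q (≤-pred q<1+n))) (∧-distribʳ-xorSum B (w q) (λ v → q ≡ᵇ g v))) ⟩
  xorSum (suc n) (λ q → xorSum B (λ v → (q ≡ᵇ g v) ∧ w q))
    ≡⟨ xorSum-cong (suc n) (λ q _ → xorSum-cong B (λ v _ → ≡ᵇ-∧-subst q (g v) w)) ⟩
  xorSum (suc n) (λ q → xorSum B (λ v → (q ≡ᵇ g v) ∧ w (g v)))
    ≡⟨ xorSum-swap (suc n) B (λ q v → (q ≡ᵇ g v) ∧ w (g v)) ⟩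
  xorSum B (λ v → xorSum (suc n) (λ q → (q ≡ᵇ g v) ∧ w (g v)))
    ≡⟨ xorSum-cong B (λ v _ → trans (xorSum-indicator (suc n) (g v) (λ _ → w (g v))) (cong (_∧ w (g v)) (<ᵇ-suc (g v) n))) ⟩
  xorSum B (λ v → (g v ≤ᵇ n) ∧ w (g v)) ∎
  where open ≡-Reasoning

-- Summing over pairs (v , t′) with v + t′ < B, along antidiagonals or by rows.
xorSum-antidiagonal : ∀ B (f : ℕ → ℕ → Bool) →
  xorSum B (λ t → xorSum (suc t) (λ v → f v (t ∸ v))) ≡ xorSum B (λ v → xorSum (B ∸ v) (f v))
xorSum-antidiagonal zero    f = refl
xorSum-antidiagonal (suc B) f = sym (begin
  xorSum (suc B) (λ v → xorSum (suc B ∸ v) (f v))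
    ≡⟨ xorSum-cong (suc B) (λ v v<1+B → trans (cong (λ k → xorSum k (f v)) (+-∸-assoc 1 (≤-pred v<1+B))) (xorSum-sucʳ (B ∸ v) (f v))) ⟩
  xorSum (suc B) (λ v → xorSum (B ∸ v) (f v) ⊕ f v (B ∸ v))
    ≡⟨ xorSum-⊕ (suc B) (λ v → xorSum (B ∸ v) (f v)) antidiagonal ⟩
  xorSum (suc B) (λ v → xorSum (B ∸ v) (f v)) ⊕ xorSum (suc B) antidiagonal
    ≡⟨ cong (_⊕ xorSum (suc B) antidiagonal) (xorSum-sucʳ B (λ v → xorSum (B ∸ v) (f v))) ⟩
  (xorSum B (λ v → xorSum (B ∸ v) (f v)) ⊕ xorSum (B ∸ B) (f B)) ⊕ xorSum (suc B) antidiagonal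
    ≡⟨ cong (λ k → (xorSum B (λ v → xorSum (B ∸ v) (f v)) ⊕ xorSum k (f B)) ⊕ xorSum (suc B) antidiagonal) (n∸n≡0 B) ⟩
  (xorSum B (λ v → xorSum (B ∸ v) (f v)) ⊕ false) ⊕ xorSum (suc B) antidiagonal
    ≡⟨ cong (_⊕ xorSum (suc B) antidiagonal) (trans (xor-identityʳ _) (sym (xorSum-antidiagonal B f))) ⟩
  xorSum B (λ t → xorSum (suc t) (λ v → f v (t ∸ v))) ⊕ xorSum (suc B) antidiagonal
    ≡⟨ sym (xorSum-sucʳ B (λ t → xorSum (suc t) (λ v → f v (t ∸ v)))) ⟩
  xorSum (suc B) (λ t → xorSum (suc t) (λ v → f v (t ∸ v))) ∎)
  where
  open ≡-Reasoning
  antidiagonal : ℕ → Bool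
  antidiagonal v = f v (B ∸ v)

-- A function f : ℕ → Bool is read as the power series Σ f(x) qˣ over 𝔽₂.

monomial : ℕ → ℕ → Bool
monomial k x = x ≡ᵇ k

shift : ℕ → (ℕ → Bool) → ℕ → Bool
shift k f x = (k ≤ᵇ x) ∧ f (x ∸ k)

shift-cong : ∀ k {f g : ℕ → Bool} → (∀ y → f y ≡ g y) → ∀ x → shift k f x ≡ shift k g x
shift-cong k eq x = cong ((k ≤ᵇ x) ∧_) (eq (x ∸ k))

shift-⊕ : ∀ k (f g : ℕ → Bool) x → shift k (λ y → f y ⊕ g y) x ≡ shift k f x ⊕ shift k g x
shift-⊕ k f g x = ∧-distribˡ-xor (k ≤ᵇ x) _ _

shift-xorSum : ∀ k n (f : ℕ → ℕ → Bool) x →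
               shift k (λ y → xorSum n (λ i → f i y)) x ≡ xorSum n (λ i → shift k (f i) x)
shift-xorSum k n f x = ∧-distribˡ-xorSum n (k ≤ᵇ x) (λ i → f i (x ∸ k))

shift-below : ∀ k f x → x < k → shift k f x ≡ false
shift-below k f x x<k = cong (_∧ f (x ∸ k)) (≤ᵇ-false (<⇒≱ x<k))

shift-shift : ∀ a b (f : ℕ → Bool) x → shift a (shift b f) x ≡ shift (a + b) f x
shift-shift a b f x with a ≤? x
... | no  a≰x rewrite ≤ᵇ-false a≰x = sym (cong (_∧ f (x ∸ (a + b))) (≤ᵇ-false (λ a+b≤x → a≰x (≤-trans (m≤m+n a b) a+b≤x))))
... | yes a≤x rewrite ≤ᵇ-true a≤x = cong₂ _∧_ (does-⇔ b≤x∸a⇔a+b≤x (b ≤? x ∸ a) (a + b ≤? x)) (cong f (∸-+-assoc x a b))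
  where
  b≤x∸a⇔a+b≤x : b ≤ x ∸ a ⇔ a + b ≤ x
  b≤x∸a⇔a+b≤x = mk⇔ (λ b≤x∸a → subst (_≤ x) (+-comm b a) (m≤o∸n⇒m+n≤o b a≤x b≤x∸a))
                    (λ a+b≤x → m+n≤o⇒m≤o∸n b (subst (_≤ x) (+-comm a b) a+b≤x))

shift-comm : ∀ a b (f : ℕ → Bool) x → shift a (shift b f) x ≡ shift b (shift a f) x
shift-comm a b f x = begin
  shift a (shift b f) x ≡⟨ shift-shift a b f x ⟩
  shift (a + b) f x     ≡⟨ cong (λ k → shift k f x) (+-comm a b) ⟩
  shift (b + a) f x     ≡⟨ sym (shift-shift b a f x) ⟩
  shift b (shift a f) x ∎
  where open ≡-Reasoning

shift-monomial : ∀ k x → shift k (monomial 0) x ≡ monomial k x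
shift-monomial k x with k ≤? x
... | no  k≰x rewrite ≤ᵇ-false k≰x = sym (≡ᵇ-false (λ x≡k → k≰x (≤-reflexive (sym x≡k))))
... | yes k≤x rewrite ≤ᵇ-true k≤x =
  does-⇔ (mk⇔ (λ x∸k≡0 → ≤-antisym (m∸n≡0⇒m≤n x∸k≡0) k≤x) (λ x≡k → trans (cong (_∸ k) x≡k) (n∸n≡0 k)))
         (x ∸ k ≟ 0) (x ≟ k)

-- Euler's pentagonal theorem mod 2

-- distinctParts j d is the mod-2 series ∏_{j < i ≤ j + d} (1 + qⁱ).
distinctParts : ℕ → ℕ → ℕ → Bool
distinctParts j zero    x = monomial 0 x
distinctParts j (suc d) x = distinctParts j d x ⊕ shift (suc (j + d)) (distinctParts j d) x

distinctParts-peel : ∀ j d x →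
  distinctParts j (suc d) x ≡ distinctParts (suc j) d x ⊕ shift (suc j) (distinctParts (suc j) d) x
distinctParts-peel j zero    x = cong (λ k → monomial 0 x ⊕ shift (suc k) (monomial 0) x) (+-identityʳ j)
distinctParts-peel j (suc d) x = begin
  distinctParts j (suc d) x ⊕ shift K (distinctParts j (suc d)) x
    ≡⟨ cong₂ _⊕_ (distinctParts-peel j d x) (shift-cong K (distinctParts-peel j d) x) ⟩
  (R x ⊕ shift (suc j) R x) ⊕ shift K (λ y → R y ⊕ shift (suc j) R y) x
    ≡⟨ cong ((R x ⊕ shift (suc j) R x) ⊕_) (shift-⊕ K R (shift (suc j) R) x) ⟩
  (R x ⊕ shift (suc j) R x) ⊕ (shift K R x ⊕ shift K (shift (suc j) R) x)
    ≡⟨ ⊕.interchange (R x) _ _ _ ⟩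
  (R x ⊕ shift K R x) ⊕ (shift (suc j) R x ⊕ shift K (shift (suc j) R) x)
    ≡⟨ cong (λ b → (R x ⊕ shift K R x) ⊕ (shift (suc j) R x ⊕ b)) (shift-comm K (suc j) R x) ⟩
  (R x ⊕ shift K R x) ⊕ (shift (suc j) R x ⊕ shift (suc j) (shift K R) x)
    ≡⟨ cong ((R x ⊕ shift K R x) ⊕_) (sym (shift-⊕ (suc j) R (shift K R) x)) ⟩
  (R x ⊕ shift K R x) ⊕ shift (suc j) (λ y → R y ⊕ shift K R y) x
    ≡⟨ cong (λ k → (R x ⊕ shift k R x) ⊕ shift (suc j) (λ y → R y ⊕ shift k R y) x) (cong suc (+-suc j d)) ⟩
  distinctParts (suc j) (suc d) x ⊕ shift (suc j) (distinctParts (suc j) (suc d)) x ∎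
  where
  open ≡-Reasoning
  R : ℕ → Bool
  R = distinctParts (suc j) d
  K : ℕ
  K = suc (j + suc d)

triangular : ℕ → ℕ
triangular zero    = 0
triangular (suc n) = suc n + triangular n

-- With ω z = z (3z − 1) / 2: pentagonal⁺ n = ω (n + 1) and pentagonal⁻ n = ω (− (n + 1)).
pentagonal⁺ pentagonal⁻ : ℕ → ℕ
pentagonal⁺ n = suc n * suc n + triangular n
pentagonal⁻ n = suc n * suc n + triangular (suc n)

pentagonalSeries : ℕ → ℕ → Bool
pentagonalSeries n x = monomial 0 x ⊕ xorSum n (λ k → monomial (pentagonal⁺ k) x ⊕ monomial (pentagonal⁻ k) x)

-- eulerSum n = Σ_{j ≤ n} q^(n j + T j) ∏_{j < i ≤ n} (1 + qⁱ), a finite form of Euler's pentagonal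
-- theorem: its term j = 0 is ∏_{i ≤ n} (1 + qⁱ), all other terms start above degree n, and
-- consecutive eulerSums differ by two pentagonal monomials.
eulerSum : ℕ → ℕ → Bool
eulerSum n x = xorSum (suc n) (λ j → shift (n * j + triangular j) (distinctParts j (n ∸ j)) x)

suc[m∸1+n]≡m∸n : ∀ {m n} → n < m → suc (m ∸ suc n) ≡ m ∸ n
suc[m∸1+n]≡m∸n {suc m} (s≤s n≤m) = sym (+-∸-assoc 1 n≤m)

eulerSum-step : ∀ n x → eulerSum (suc n) x ⊕ eulerSum n x ≡ monomial (pentagonal⁺ n) x ⊕ monomial (pentagonal⁻ n) x
eulerSum-step n x = begin
  eulerSum N x ⊕ eulerSum n x
    ≡⟨ cong (_⊕ eulerSum n x) (xorSum-sucʳ N next) ⟩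
  (xorSum N next ⊕ next N) ⊕ xorSum N current
    ≡⟨ ⊕.xy∙z≈xz∙y (xorSum N next) (next N) _ ⟩
  (xorSum N next ⊕ xorSum N current) ⊕ next N
    ≡⟨ cong (_⊕ next N) (sym (xorSum-⊕ N next current)) ⟩
  xorSum N (λ j → next j ⊕ current j) ⊕ next N
    ≡⟨ cong (_⊕ next N) (xorSum-cong N (λ j j<N → next⊕current j (≤-pred j<N))) ⟩
  xorSum N (λ j → low j ⊕ high j) ⊕ next N
    ≡⟨ cong (_⊕ next N) (xorSum-⊕ N low high) ⟩
  (xorSum N low ⊕ xorSum N high) ⊕ next N
    ≡⟨ cong (λ b → (b ⊕ xorSum N high) ⊕ next N) (cong₂ _⊕_ low-zero (xorSum-cong n low-suc)) ⟩
  (xorSum n high ⊕ xorSum N high) ⊕ next N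
    ≡⟨ cong (λ b → (xorSum n high ⊕ b) ⊕ next N) (xorSum-sucʳ n high) ⟩
  (xorSum n high ⊕ (xorSum n high ⊕ high n)) ⊕ next N
    ≡⟨ cong (_⊕ next N) (⊕-cancelˡ (xorSum n high) (high n)) ⟩
  high n ⊕ next N
    ≡⟨ cong₂ _⊕_ high-last next-last ⟩
  monomial (pentagonal⁺ n) x ⊕ monomial (pentagonal⁻ n) x ∎
  where
  open ≡-Reasoning
  open +-*-Solver
  N : ℕ
  N = suc n
  R : ℕ → ℕ → Bool
  R j = distinctParts j (n ∸ j)
  next current low high : ℕ → Bool
  next j    = shift (N * j + triangular j) (distinctParts j (N ∸ j)) x
  current j = shift (n * j + triangular j) (R j) x
  low j     = shift (n * j + triangular j) (λ y → R j y ⊕ shift j (R j) y) x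
  high j    = shift (N * j + triangular j + N) (R j) x

  next⊕current : ∀ j → j ≤ n → next j ⊕ current j ≡ low j ⊕ high j
  next⊕current j j≤n = begin
    next j ⊕ current j
      ≡⟨ cong (_⊕ current j) (shift-cong E (λ y → cong (λ d → distinctParts j d y) (+-∸-assoc 1 j≤n)) x) ⟩
    shift E (λ y → R j y ⊕ shift (suc (j + (n ∸ j))) (R j) y) x ⊕ current j
      ≡⟨ cong (λ k → shift E (λ y → R j y ⊕ shift (suc k) (R j) y) x ⊕ current j) (m+[n∸m]≡n j≤n) ⟩
    shift E (λ y → R j y ⊕ shift N (R j) y) x ⊕ current j
      ≡⟨ cong (_⊕ current j) (shift-⊕ E (R j) (shift N (R j)) x) ⟩
    (shift E (R j) x ⊕ shift E (shift N (R j)) x) ⊕ current j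
      ≡⟨ cong₂ (λ u v → (u ⊕ v) ⊕ current j) (trans (cong (λ k → shift k (R j) x) E≡e+j) (sym (shift-shift e j (R j) x)))
                                              (shift-shift E N (R j) x) ⟩
    (shift e (shift j (R j)) x ⊕ high j) ⊕ current j
      ≡⟨ ⊕.xy∙z≈zx∙y (shift e (shift j (R j)) x) (high j) (current j) ⟩
    (current j ⊕ shift e (shift j (R j)) x) ⊕ high j
      ≡⟨ cong (_⊕ high j) (sym (shift-⊕ e (R j) (shift j (R j)) x)) ⟩
    low j ⊕ high j ∎
    where
    E e : ℕ
    E = N * j + triangular j
    e = n * j + triangular j
    E≡e+j : E ≡ e + j
    E≡e+j = solve 3 (λ n j t → (con 1 :+ n) :* j :+ t := n :* j :+ t :+ j) refl n j (triangular j)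

  low-zero : low 0 ≡ false
  low-zero = trans (shift-cong (n * 0 + triangular 0) (λ y → xor-same (R 0 y)) x) (∧-zeroʳ _)

  low-suc : ∀ j → j < n → low (suc j) ≡ high j
  low-suc j j<n = trans (shift-cong (n * suc j + triangular (suc j)) factor x)
                        (cong (λ k → shift k (R j) x) (solve 3 (λ n j t → n :* (con 1 :+ j) :+ ((con 1 :+ j) :+ t)
                                                                  := (con 1 :+ n) :* j :+ t :+ (con 1 :+ n)) refl n j (triangular j)))
    where
    factor : ∀ y → R (suc j) y ⊕ shift (suc j) (R (suc j)) y ≡ R j y
    factor y = trans (sym (distinctParts-peel j (n ∸ suc j) y)) (cong (λ d → distinctParts j d y) (suc[m∸1+n]≡m∸n j<n))

  high-last : high n ≡ monomial (pentagonal⁺ n) x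
  high-last = begin
    shift (N * n + triangular n + N) (distinctParts n (n ∸ n)) x
      ≡⟨ shift-cong (N * n + triangular n + N) (λ y → cong (λ d → distinctParts n d y) (n∸n≡0 n)) x ⟩
    shift (N * n + triangular n + N) (monomial 0) x
      ≡⟨ shift-monomial _ x ⟩
    monomial (N * n + triangular n + N) x
      ≡⟨ cong (λ k → monomial k x) (solve 2 (λ n t → (con 1 :+ n) :* n :+ t :+ (con 1 :+ n)
                                              := (con 1 :+ n) :* (con 1 :+ n) :+ t) refl n (triangular n)) ⟩
    monomial (pentagonal⁺ n) x ∎

  next-last : next N ≡ monomial (pentagonal⁻ n) x
  next-last = trans (shift-cong (N * N + triangular N) (λ y → cong (λ d → distinctParts N d y) (n∸n≡0 N)) x) (shift-monomial _ x)

pentagonalTerm : ℕ → ℕ → Bool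
pentagonalTerm k x = monomial (pentagonal⁺ k) x ⊕ monomial (pentagonal⁻ k) x

pentagonalSeries-sucʳ : ∀ n x → pentagonalSeries (suc n) x ≡ pentagonalSeries n x ⊕ pentagonalTerm n x
pentagonalSeries-sucʳ n x =
  trans (cong (monomial 0 x ⊕_) (xorSum-sucʳ n (λ k → pentagonalTerm k x))) (sym (xor-assoc (monomial 0 x) _ _))

eulerSum≡pentagonalSeries : ∀ n x → eulerSum n x ≡ pentagonalSeries n x
eulerSum≡pentagonalSeries zero    x = refl
eulerSum≡pentagonalSeries (suc n) x = begin
  eulerSum (suc n) x                         ≡⟨ ⊕-transpose (eulerSum-step n x) ⟩
  pentagonalTerm n x ⊕ eulerSum n x          ≡⟨ cong (pentagonalTerm n x ⊕_) (eulerSum≡pentagonalSeries n x) ⟩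
  pentagonalTerm n x ⊕ pentagonalSeries n x  ≡⟨ xor-comm (pentagonalTerm n x) _ ⟩
  pentagonalSeries n x ⊕ pentagonalTerm n x  ≡⟨ sym (pentagonalSeries-sucʳ n x) ⟩
  pentagonalSeries (suc n) x                 ∎
  where open ≡-Reasoning

eulerSum≡distinctParts : ∀ n x → x ≤ n → eulerSum n x ≡ distinctParts 0 n x
eulerSum≡distinctParts n x x≤n = begin
  shift (n * 0 + 0) (distinctParts 0 n) x ⊕ xorSum n higherTerm
    ≡⟨ cong₂ _⊕_ (cong (λ k → shift (k + 0) (distinctParts 0 n) x) (*-zeroʳ n))
                 (xorSum-false n (λ j _ → shift-below _ (distinctParts (suc j) (n ∸ suc j)) x (x<offset j))) ⟩
  distinctParts 0 n x ⊕ false                                   ≡⟨ xor-identityʳ _ ⟩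
  distinctParts 0 n x                                           ∎
  where
  open ≡-Reasoning
  higherTerm : ℕ → Bool
  higherTerm j = shift (n * suc j + triangular (suc j)) (distinctParts (suc j) (n ∸ suc j)) x
  x<offset : ∀ j → x < n * suc j + triangular (suc j)
  x<offset j = ≤-<-trans (≤-trans x≤n (m≤m*n n (suc j))) (m<m+n (n * suc j) z<s)

distinctParts≡pentagonalSeries : ∀ n x → x ≤ n → distinctParts 0 n x ≡ pentagonalSeries n x
distinctParts≡pentagonalSeries n x x≤n = trans (sym (eulerSum≡distinctParts n x x≤n)) (eulerSum≡pentagonalSeries n x)

IsPentagonal : ℕ → Set
IsPentagonal x = x ≡ 0 ⊎ ∃ λ j → x ≡ pentagonal⁺ j ⊎ x ≡ pentagonal⁻ j

pentagonal⁺<pentagonal⁻ : ∀ j → pentagonal⁺ j < pentagonal⁻ j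
pentagonal⁺<pentagonal⁻ j = +-monoʳ-< (suc j * suc j) (m<n+m (triangular j) z<s)

pentagonal⁻<pentagonal⁺-suc : ∀ j → pentagonal⁻ j < pentagonal⁺ (suc j)
pentagonal⁻<pentagonal⁺-suc j = +-monoˡ-< (triangular (suc j)) (*-mono-< (n<1+n (suc j)) (n<1+n (suc j)))

pentagonal⁻<pentagonal⁺ : ∀ {i j} → i < j → pentagonal⁻ i < pentagonal⁺ j
pentagonal⁻<pentagonal⁺ {i} {suc j} (s≤s i≤j) with m≤n⇒m<n∨m≡n i≤j
... | inj₁ i<j  = <-trans (pentagonal⁻<pentagonal⁺ i<j)
                          (<-trans (pentagonal⁺<pentagonal⁻ j) (pentagonal⁻<pentagonal⁺-suc j))
... | inj₂ refl = pentagonal⁻<pentagonal⁺-suc i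

pentagonal⁺-monotone : ∀ {i j} → i < j → pentagonal⁺ i < pentagonal⁺ j
pentagonal⁺-monotone {i} i<j = <-trans (pentagonal⁺<pentagonal⁻ i) (pentagonal⁻<pentagonal⁺ i<j)

n<pentagonal⁺ : ∀ n → n < pentagonal⁺ n
n<pentagonal⁺ n = ≤-trans (m≤m*n (suc n) (suc n)) (m≤m+n (suc n * suc n) (triangular n))

pentagonalTerm-false : ∀ k {x} → x ≢ pentagonal⁺ k → x ≢ pentagonal⁻ k → pentagonalTerm k x ≡ false
pentagonalTerm-false k x≢p⁺ x≢p⁻ = cong₂ _⊕_ (≡ᵇ-false x≢p⁺) (≡ᵇ-false x≢p⁻)

pentagonalTerm-below : ∀ k {x} → x < pentagonal⁺ k → pentagonalTerm k x ≡ false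
pentagonalTerm-below k x<p⁺ =
  pentagonalTerm-false k (<⇒≢ x<p⁺) (<⇒≢ (<-trans x<p⁺ (pentagonal⁺<pentagonal⁻ k)))

pentagonalSeries-zero : ∀ n → pentagonalSeries n 0 ≡ true
pentagonalSeries-zero n = cong (true ⊕_) (xorSum-false n (λ _ _ → refl))

pentagonalSeries-above : ∀ n x → pentagonal⁺ n ≤ x → pentagonalSeries n x ≡ false
pentagonalSeries-above zero    x p⁺≤x = trans (xor-identityʳ _) (≡ᵇ-false (λ x≡0 → 1+n≰n (subst (1 ≤_) x≡0 p⁺≤x)))
pentagonalSeries-above (suc n) x p⁺≤x = begin
  pentagonalSeries (suc n) x                  ≡⟨ pentagonalSeries-sucʳ n x ⟩
  pentagonalSeries n x ⊕ pentagonalTerm n x   ≡⟨ cong₂ _⊕_ (pentagonalSeries-above n x (<⇒≤ p⁺<x))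
                                                            (pentagonalTerm-false n (>⇒≢ p⁺<x) (>⇒≢ p⁻<x)) ⟩
  false                                       ∎
  where
  open ≡-Reasoning
  p⁺<x : pentagonal⁺ n < x
  p⁺<x = <-≤-trans (pentagonal⁺-monotone (n<1+n n)) p⁺≤x
  p⁻<x : pentagonal⁻ n < x
  p⁻<x = <-≤-trans (pentagonal⁻<pentagonal⁺-suc n) p⁺≤x

pentagonalSeries⇒IsPentagonal : ∀ n x → pentagonalSeries n x ≡ true → IsPentagonal x
pentagonalSeries⇒IsPentagonal zero    x eq = inj₁ (≡ᵇ-sound (trans (sym (xor-identityʳ _)) eq))
pentagonalSeries⇒IsPentagonal (suc n) x eq with x ≟ pentagonal⁺ n | x ≟ pentagonal⁻ n
... | yes x≡p⁺ | _         = inj₂ (n , inj₁ x≡p⁺)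
... | no  _    | yes x≡p⁻  = inj₂ (n , inj₂ x≡p⁻)
... | no x≢p⁺  | no x≢p⁻   = pentagonalSeries⇒IsPentagonal n x (begin
  pentagonalSeries n x                        ≡⟨ sym (xor-identityʳ _) ⟩
  pentagonalSeries n x ⊕ false                ≡⟨ cong (pentagonalSeries n x ⊕_) (sym (pentagonalTerm-false n x≢p⁺ x≢p⁻)) ⟩
  pentagonalSeries n x ⊕ pentagonalTerm n x   ≡⟨ sym (pentagonalSeries-sucʳ n x) ⟩
  pentagonalSeries (suc n) x                  ≡⟨ eq ⟩
  true                                        ∎)
  where open ≡-Reasoning

pentagonalSeries-pentagonal : ∀ n x j → j < n → x ≡ pentagonal⁺ j ⊎ x ≡ pentagonal⁻ j → pentagonalSeries n x ≡ true
pentagonalSeries-pentagonal (suc n) x j (s≤s j≤n) x≡p with m≤n⇒m<n∨m≡n j≤n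
... | inj₁ j<n = trans (pentagonalSeries-sucʳ n x)
                       (cong₂ _⊕_ (pentagonalSeries-pentagonal n x j j<n x≡p) (pentagonalTerm-below n (x<p⁺ x≡p)))
  where
  x<p⁺ : x ≡ pentagonal⁺ j ⊎ x ≡ pentagonal⁻ j → x < pentagonal⁺ n
  x<p⁺ (inj₁ x≡p⁺) = subst (_< pentagonal⁺ n) (sym x≡p⁺) (pentagonal⁺-monotone j<n)
  x<p⁺ (inj₂ x≡p⁻) = subst (_< pentagonal⁺ n) (sym x≡p⁻) (pentagonal⁻<pentagonal⁺ j<n)
... | inj₂ refl = trans (pentagonalSeries-sucʳ j x) (cong₂ _⊕_ (pentagonalSeries-above j x (p⁺≤x x≡p)) (newTerm x≡p))
  where
  p⁺<p⁻ : pentagonal⁺ j < pentagonal⁻ j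
  p⁺<p⁻ = pentagonal⁺<pentagonal⁻ j
  p⁺≤x : x ≡ pentagonal⁺ j ⊎ x ≡ pentagonal⁻ j → pentagonal⁺ j ≤ x
  p⁺≤x (inj₁ x≡p⁺) = ≤-reflexive (sym x≡p⁺)
  p⁺≤x (inj₂ x≡p⁻) = subst (pentagonal⁺ j ≤_) (sym x≡p⁻) (<⇒≤ p⁺<p⁻)
  newTerm : x ≡ pentagonal⁺ j ⊎ x ≡ pentagonal⁻ j → pentagonalTerm j x ≡ true
  newTerm (inj₁ x≡p⁺) = cong₂ _⊕_ (≡ᵇ-true x≡p⁺) (≡ᵇ-false (λ x≡p⁻ → <⇒≢ p⁺<p⁻ (trans (sym x≡p⁺) x≡p⁻)))
  newTerm (inj₂ x≡p⁻) = cong₂ _⊕_ (≡ᵇ-false (λ x≡p⁺ → <⇒≢ p⁺<p⁻ (trans (sym x≡p⁺) x≡p⁻))) (≡ᵇ-true x≡p⁻)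

IsPentagonal⇒pentagonalSeries : ∀ K → IsPentagonal K → pentagonalSeries K K ≡ true
IsPentagonal⇒pentagonalSeries K (inj₁ refl)          = pentagonalSeries-zero 0
IsPentagonal⇒pentagonalSeries K (inj₂ (j , inj₁ K≡p⁺)) =
  pentagonalSeries-pentagonal K K j (subst (j <_) (sym K≡p⁺) (n<pentagonal⁺ j)) (inj₁ K≡p⁺)
IsPentagonal⇒pentagonalSeries K (inj₂ (j , inj₂ K≡p⁻)) =
  pentagonalSeries-pentagonal K K j (subst (j <_) (sym K≡p⁻) (<-trans (n<pentagonal⁺ j) (pentagonal⁺<pentagonal⁻ j))) (inj₂ K≡p⁻)

-- Partitions with restricted parts

module _ {Ok : ℕ → Set} (ok? : ∀ x → Dec (Ok x)) where

  allowedPart : ℕ → ℕ → Bool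
  allowedPart k p = (p ≤ᵇ k) ∧ does (ok? p)

  -- restrictedParts ℓ k n: parity of the number of partitions of n into exactly ℓ parts,
  -- each ≤ k and satisfying Ok, counted by their largest part.
  restrictedParts : ℕ → ℕ → ℕ → Bool
  restrictedParts zero    k n = n ≡ᵇ 0
  restrictedParts (suc ℓ) k n = xorSum n (λ p → allowedPart k (suc p) ∧ restrictedParts ℓ (suc p) (n ∸ suc p))

  restrictedParts-bound : ∀ ℓ {k k′} x → x ≤ k → x ≤ k′ → restrictedParts ℓ k x ≡ restrictedParts ℓ k′ x
  restrictedParts-bound zero    x x≤k x≤k′ = refl
  restrictedParts-bound (suc ℓ) x x≤k x≤k′ = xorSum-cong x (λ p p<x →
    cong (λ b → (b ∧ does (ok? (suc p))) ∧ restrictedParts ℓ (suc p) (x ∸ suc p))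
         (trans (≤ᵇ-true (≤-trans p<x x≤k)) (sym (≤ᵇ-true (≤-trans p<x x≤k′)))))

  xorList-partsLe : ∀ fuel n → n ≤ fuel → ∀ k (h : ℕ → ℕ → Bool) B → n < B →
    xorList (λ γ → h (length γ) (sum γ)) (filter (all? ok?) (partsLe fuel n k))
      ≡ xorSum B (λ ℓ → h ℓ n ∧ restrictedParts ℓ k n)
  xorList-partsLe fuel zero _ k h (suc B) _ = begin
    h 0 0 ⊕ false                                            ≡⟨ xor-identityʳ _ ⟩
    h 0 0                                                    ≡⟨ sym (∧-identityʳ _) ⟩
    h 0 0 ∧ true                                             ≡⟨ sym (xor-identityʳ _) ⟩
    (h 0 0 ∧ true) ⊕ false                                   ≡⟨ cong ((h 0 0 ∧ true) ⊕_) (sym (xorSum-false B (λ ℓ _ → ∧-zeroʳ (h (suc ℓ) 0)))) ⟩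
    (h 0 0 ∧ true) ⊕ xorSum B (λ ℓ → h (suc ℓ) 0 ∧ false)    ∎
    where open ≡-Reasoning
  xorList-partsLe (suc fuel) (suc n) (s≤s n≤fuel) k h (suc B) (s≤s n<B) = begin
    xorList H (filter (all? ok?) (concatMap withLargest candidates))
      ≡⟨ xorList-filter (all? ok?) H (concatMap withLargest candidates) ⟩
    xorList okH (concatMap withLargest candidates)
      ≡⟨ xorList-concatMap okH withLargest candidates ⟩
    xorList (λ p → xorList okH (withLargest p)) candidates
      ≡⟨ xorList-filter (_≤? k) (λ p → xorList okH (withLargest p)) (map suc (upTo (suc n))) ⟩
    xorList largestWeight (map suc (upTo (suc n)))
      ≡⟨ trans (xorList-map largestWeight suc (upTo (suc n))) (xorList-upTo (largestWeight ∘ suc) (suc n)) ⟩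
    xorSum (suc n) (λ i → (suc i ≤ᵇ k) ∧ xorList okH (withLargest (suc i)))
      ≡⟨ xorSum-cong (suc n) (λ i i<1+n → trans (cong ((suc i ≤ᵇ k) ∧_) (largest i (≤-pred i<1+n)))
                                                (sym (∧-assoc (suc i ≤ᵇ k) (does (ok? (suc i))) _))) ⟩
    xorSum (suc n) (λ i → allowedPart k (suc i) ∧ xorSum B (λ ℓ → h (suc ℓ) (suc n) ∧ restrictedParts ℓ (suc i) (n ∸ i)))
      ≡⟨ xorSum-swap-∧ (suc n) B (allowedPart k ∘ suc) (λ ℓ → h (suc ℓ) (suc n)) (λ i ℓ → restrictedParts ℓ (suc i) (n ∸ i)) ⟩
    xorSum B (λ ℓ → h (suc ℓ) (suc n) ∧ restrictedParts (suc ℓ) k (suc n))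
      ≡⟨ cong (_⊕ xorSum B (λ ℓ → h (suc ℓ) (suc n) ∧ restrictedParts (suc ℓ) k (suc n))) (sym (∧-zeroʳ (h 0 (suc n)))) ⟩
    xorSum (suc B) (λ ℓ → h ℓ (suc n) ∧ restrictedParts ℓ k (suc n)) ∎
    where
    open ≡-Reasoning
    H okH : List ℕ → Bool
    H γ   = h (length γ) (sum γ)
    okH γ = does (all? ok? γ) ∧ H γ
    candidates : List ℕ
    candidates = filter (_≤? k) (map suc (upTo (suc n)))
    withLargest : ℕ → List (List ℕ)
    withLargest p = map (p ∷_) (partsLe fuel (suc n ∸ p) p)
    largestWeight : ℕ → Bool
    largestWeight p = (p ≤ᵇ k) ∧ xorList okH (withLargest p)
    largest : ∀ i → i ≤ n → xorList okH (withLargest (suc i))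
              ≡ does (ok? (suc i)) ∧ xorSum B (λ ℓ → h (suc ℓ) (suc n) ∧ restrictedParts ℓ (suc i) (n ∸ i))
    largest i i≤n = begin
      xorList okH (withLargest (suc i))
        ≡⟨ xorList-map okH (suc i ∷_) (partsLe fuel (n ∸ i) (suc i)) ⟩
      xorList (λ γ → (does (ok? (suc i)) ∧ does (all? ok? γ)) ∧ H′ γ) rest
        ≡⟨ xorList-cong rest (λ γ → ∧-assoc (does (ok? (suc i))) _ _) ⟩
      xorList (λ γ → does (ok? (suc i)) ∧ (does (all? ok? γ) ∧ H′ γ)) rest
        ≡⟨ sym (∧-distribˡ-xorList (does (ok? (suc i))) _ rest) ⟩
      does (ok? (suc i)) ∧ xorList (λ γ → does (all? ok? γ) ∧ H′ γ) rest
        ≡⟨ cong (does (ok? (suc i)) ∧_) (sym (xorList-filter (all? ok?) H′ rest)) ⟩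
      does (ok? (suc i)) ∧ xorList H′ (filter (all? ok?) rest)
        ≡⟨ cong (does (ok? (suc i)) ∧_) (xorList-partsLe fuel (n ∸ i) (≤-trans (m∸n≤m n i) n≤fuel) (suc i)
                                            (λ ℓ s → h (suc ℓ) (suc i + s)) B (≤-<-trans (m∸n≤m n i) n<B)) ⟩
      does (ok? (suc i)) ∧ xorSum B (λ ℓ → h (suc ℓ) (suc i + (n ∸ i)) ∧ restrictedParts ℓ (suc i) (n ∸ i))
        ≡⟨ cong (λ s → does (ok? (suc i)) ∧ xorSum B (λ ℓ → h (suc ℓ) (suc s) ∧ restrictedParts ℓ (suc i) (n ∸ i))) (m+[n∸m]≡n i≤n) ⟩
      does (ok? (suc i)) ∧ xorSum B (λ ℓ → h (suc ℓ) (suc n) ∧ restrictedParts ℓ (suc i) (n ∸ i)) ∎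
      where
      rest : List (List ℕ)
      rest = partsLe fuel (n ∸ i) (suc i)
      H′ : List ℕ → Bool
      H′ γ = h (suc (length γ)) (suc i + sum γ)

-- boundedParts ℓ M t: parity of the number of partitions of t into at most ℓ parts, each ≤ M,
-- counted by the largest part v.
boundedParts : ℕ → ℕ → ℕ → Bool
boundedParts zero    M t = t ≡ᵇ 0
boundedParts (suc ℓ) M t = xorSum (suc t) (λ v → (v ≤ᵇ M) ∧ boundedParts ℓ v (t ∸ v))

boundedParts-bound : ∀ ℓ {M M′} t → t ≤ M → t ≤ M′ → boundedParts ℓ M t ≡ boundedParts ℓ M′ t
boundedParts-bound zero    t t≤M t≤M′ = refl
boundedParts-bound (suc ℓ) t t≤M t≤M′ = xorSum-cong (suc t) (λ v v<1+t →
  cong (_∧ boundedParts ℓ v (t ∸ v)) (trans (≤ᵇ-true (≤-trans (≤-pred v<1+t) t≤M)) (sym (≤ᵇ-true (≤-trans (≤-pred v<1+t) t≤M′)))))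

module Progression (a m : ℕ) .{{_ : NonZero a}} .{{_ : NonZero m}} where

  ok? : ∀ q → Dec (PartOk a m q)
  ok? = partOk? a m

  progression : ℕ → ℕ
  progression v = a + m * v

  progression-ok : ∀ v → PartOk a m (progression v)
  progression-ok v = m≤m+n a (m * v) , divides v (trans (m+n∸m≡n a (m * v)) (*-comm m v))

  ok⇒progression : ∀ {q} → PartOk a m q → ∃ λ v → q ≡ progression v
  ok⇒progression (a≤q , divides v q∸a≡v*m) =
    v , trans (sym (m+[n∸m]≡n a≤q)) (cong (λ u → a + u) (trans q∸a≡v*m (*-comm v m)))

  v<progression : ∀ v → v < progression v
  v<progression v = ≤-<-trans (m≤n*m v m) (m<n+m (m * v) (>-nonZero⁻¹ a))

  progression-≤ᵇ : ∀ v w → (progression v ≤ᵇ progression w) ≡ (v ≤ᵇ w)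
  progression-≤ᵇ v w = does-⇔ (mk⇔ (λ le → *-cancelˡ-≤ m (+-cancelˡ-≤ a _ _ le)) (λ le → +-monoʳ-≤ a (*-monoʳ-≤ m le)))
                              (progression v ≤? progression w) (v ≤? w)

  ok-zero : does (ok? 0) ≡ false
  ok-zero = dec-false (ok? 0) (λ (a≤0 , _) → ≢-nonZero⁻¹ a (n≤0⇒n≡0 a≤0))

  ok≡xorSum : ∀ q B → q < B → does (ok? q) ≡ xorSum B (λ v → q ≡ᵇ progression v)
  ok≡xorSum q B q<B with ok? q
  ... | no ¬ok = trans (dec-false (ok? q) ¬ok) (sym (xorSum-false B (λ v _ → ≡ᵇ-false (λ q≡pv → ¬ok (subst (PartOk a m) (sym q≡pv) (progression-ok v))))))
  ... | yes ok with ok⇒progression ok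
  ...   | v , refl = trans (dec-true (ok? q) ok) (sym (begin
    xorSum B (λ w → progression v ≡ᵇ progression w) ≡⟨ xorSum-cong B (λ w _ → trans (does-⇔ pv≡pw⇔w≡v (_ ≟ _) (w ≟ v)) (sym (∧-identityʳ _))) ⟩
    xorSum B (λ w → (w ≡ᵇ v) ∧ true)                ≡⟨ xorSum-indicator B v (λ _ → true) ⟩
    (v <ᵇ B) ∧ true                                 ≡⟨ cong (_∧ true) (≤ᵇ-true (<-trans (v<progression v) q<B)) ⟩
    true                                            ∎))
    where
    open ≡-Reasoning
    pv≡pw⇔w≡v : ∀ {w} → progression v ≡ progression w ⇔ w ≡ v
    pv≡pw⇔w≡v = mk⇔ (λ e → sym (*-cancelˡ-≡ _ _ m (+-cancelˡ-≡ a _ _ e))) (λ e → cong progression (sym e))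

  -- largestSplit ℓ M n v t: a partition of n into 1 + ℓ progression parts whose largest part is
  -- a + m v ≤ a + m M, the other ℓ parts being a + m vᵢ with Σ vᵢ = t.
  largestSplit : ℕ → ℕ → ℕ → ℕ → ℕ → Bool
  largestSplit ℓ M n v t =
    (progression v ≤ᵇ n) ∧ ((v ≤ᵇ M) ∧ ((n ∸ progression v ≡ᵇ a * ℓ + m * t) ∧ boundedParts ℓ v t))

  largestSplit-outside : ∀ ℓ M n B v t → n < B → B ∸ v ≤ t → largestSplit ℓ M n v t ≡ false
  largestSplit-outside ℓ M n B v t n<B B∸v≤t with progression v ≤? n | n ∸ progression v ≟ a * ℓ + m * t
  ... | no pv≰n | _ =
    cong (_∧ ((v ≤ᵇ M) ∧ ((n ∸ progression v ≡ᵇ a * ℓ + m * t) ∧ boundedParts ℓ v t))) (≤ᵇ-false pv≰n)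
  ... | yes _ | no n∸pv≢ =
    trans (cong (λ b → (progression v ≤ᵇ n) ∧ ((v ≤ᵇ M) ∧ (b ∧ boundedParts ℓ v t))) (≡ᵇ-false n∸pv≢))
          (trans (cong ((progression v ≤ᵇ n) ∧_) (∧-zeroʳ (v ≤ᵇ M))) (∧-zeroʳ _))
  ... | yes pv≤n | yes n∸pv≡ = ⊥-elim (<⇒≱ v+t<B (≤-trans (m≤n+m∸n B v) (+-monoʳ-≤ v B∸v≤t)))
    where
    t≤n∸pv : t ≤ n ∸ progression v
    t≤n∸pv = subst (t ≤_) (sym n∸pv≡) (≤-trans (m≤n*m t m) (m≤n+m (m * t) (a * ℓ)))
    v+t<B : v + t < B
    v+t<B = <-trans (subst (v + t <_) (m+[n∸m]≡n pv≤n) (+-mono-<-≤ (v<progression v) t≤n∸pv)) n<B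

  boundedParts≡largestSplit : ∀ ℓ M n B → n < B →
    xorSum B (λ t → (n ≡ᵇ a * suc ℓ + m * t) ∧ boundedParts (suc ℓ) M t) ≡ xorSum B (λ v → xorSum B (largestSplit ℓ M n v))
  boundedParts≡largestSplit ℓ M n B n<B = begin
    xorSum B (λ t → (n ≡ᵇ a * suc ℓ + m * t) ∧ boundedParts (suc ℓ) M t)
      ≡⟨ xorSum-cong B (λ t _ → trans (∧-distribˡ-xorSum (suc t) (n ≡ᵇ a * suc ℓ + m * t) (λ v → (v ≤ᵇ M) ∧ boundedParts ℓ v (t ∸ v)))
                                      (xorSum-cong (suc t) (λ v v<1+t → largest v t (≤-pred v<1+t)))) ⟩
    xorSum B (λ t → xorSum (suc t) (λ v → largestSplit ℓ M n v (t ∸ v)))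
      ≡⟨ xorSum-antidiagonal B (largestSplit ℓ M n) ⟩
    xorSum B (λ v → xorSum (B ∸ v) (largestSplit ℓ M n v))
      ≡⟨ xorSum-cong B (λ v _ → xorSum-extend (largestSplit ℓ M n v) (m∸n≤m B v)
                                              (λ t B∸v≤t _ → largestSplit-outside ℓ M n B v t n<B B∸v≤t)) ⟩
    xorSum B (λ v → xorSum B (largestSplit ℓ M n v)) ∎
    where
    open ≡-Reasoning
    open +-*-Solver
    largest : ∀ v t → v ≤ t →
      (n ≡ᵇ a * suc ℓ + m * t) ∧ ((v ≤ᵇ M) ∧ boundedParts ℓ v (t ∸ v)) ≡ largestSplit ℓ M n v (t ∸ v)
    largest v t v≤t = begin
      (n ≡ᵇ a * suc ℓ + m * t) ∧ ((v ≤ᵇ M) ∧ boundedParts ℓ v (t ∸ v))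
        ≡⟨ cong (λ s → (n ≡ᵇ s) ∧ ((v ≤ᵇ M) ∧ boundedParts ℓ v (t ∸ v))) size≡ ⟩
      (n ≡ᵇ progression v + (a * ℓ + m * (t ∸ v))) ∧ ((v ≤ᵇ M) ∧ boundedParts ℓ v (t ∸ v))
        ≡⟨ cong (_∧ ((v ≤ᵇ M) ∧ boundedParts ℓ v (t ∸ v))) (≡ᵇ-+ n (progression v) (a * ℓ + m * (t ∸ v))) ⟩
      ((progression v ≤ᵇ n) ∧ (n ∸ progression v ≡ᵇ a * ℓ + m * (t ∸ v))) ∧ ((v ≤ᵇ M) ∧ boundedParts ℓ v (t ∸ v))
        ≡⟨ ∧-assoc (progression v ≤ᵇ n) _ _ ⟩
      (progression v ≤ᵇ n) ∧ ((n ∸ progression v ≡ᵇ a * ℓ + m * (t ∸ v)) ∧ ((v ≤ᵇ M) ∧ boundedParts ℓ v (t ∸ v)))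
        ≡⟨ cong ((progression v ≤ᵇ n) ∧_) (∧.x∙yz≈y∙xz (n ∸ progression v ≡ᵇ a * ℓ + m * (t ∸ v)) (v ≤ᵇ M) _) ⟩
      largestSplit ℓ M n v (t ∸ v) ∎
      where
      size≡ : a * suc ℓ + m * t ≡ progression v + (a * ℓ + m * (t ∸ v))
      size≡ = trans (cong (λ s → a * suc ℓ + m * s) (sym (m+[n∸m]≡n v≤t)))
                    (solve 5 (λ a l m v u → a :* (con 1 :+ l) :+ m :* (v :+ u) := (a :+ m :* v) :+ (a :* l :+ m :* u))
                           refl a ℓ m v (t ∸ v))

  -- A partition into ℓ parts a + m vᵢ (v₁ ≥ … ≥ v_ℓ ≥ 0) has size a ℓ + m (v₁ + … + v_ℓ).
  restrictedParts-progression : ∀ ℓ M n B → n < B →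
    restrictedParts ok? ℓ (progression M) n ≡ xorSum B (λ t → (n ≡ᵇ a * ℓ + m * t) ∧ boundedParts ℓ M t)
  restrictedParts-progression zero M n (suc B) _ = sym (begin
    xorSum (suc B) (λ t → (n ≡ᵇ a * 0 + m * t) ∧ (t ≡ᵇ 0))
      ≡⟨ xorSum-cong (suc B) (λ t _ → trans (∧-comm (n ≡ᵇ a * 0 + m * t) (t ≡ᵇ 0)) (≡ᵇ-∧-subst t 0 (λ u → n ≡ᵇ a * 0 + m * u))) ⟩
    xorSum (suc B) (λ t → (t ≡ᵇ 0) ∧ (n ≡ᵇ a * 0 + m * 0))
      ≡⟨ xorSum-indicator (suc B) 0 (λ _ → n ≡ᵇ a * 0 + m * 0) ⟩
    (n ≡ᵇ a * 0 + m * 0)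
      ≡⟨ cong (n ≡ᵇ_) (cong₂ _+_ (*-zeroʳ a) (*-zeroʳ m)) ⟩
    (n ≡ᵇ 0) ∎)
    where open ≡-Reasoning
  restrictedParts-progression (suc ℓ) M n B n<B = begin
    xorSum n (λ p → allowedPart ok? (progression M) (suc p) ∧ restrictedParts ok? ℓ (suc p) (n ∸ suc p))
      ≡⟨ xorSum-cong n (λ p _ → ∧.xy∙z≈y∙xz (suc p ≤ᵇ progression M) (does (ok? (suc p))) _) ⟩
    xorSum n (λ p → does (ok? (suc p)) ∧ weight (suc p))
      ≡⟨ cong (_⊕ xorSum n (λ p → does (ok? (suc p)) ∧ weight (suc p))) (sym (cong (_∧ weight 0) ok-zero)) ⟩
    xorSum (suc n) (λ q → does (ok? q) ∧ weight q)
      ≡⟨ xorSum-reindex n B (does ∘ ok?) weight progression (λ q q≤n → ok≡xorSum q B (≤-<-trans q≤n n<B)) ⟩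
    xorSum B (λ v → (progression v ≤ᵇ n) ∧ weight (progression v))
      ≡⟨ xorSum-cong B (λ v _ → cong ((progression v ≤ᵇ n) ∧_) (cong₂ _∧_ (progression-≤ᵇ v M)
           (restrictedParts-progression ℓ v (n ∸ progression v) B (≤-<-trans (m∸n≤m n (progression v)) n<B)))) ⟩
    xorSum B (λ v → (progression v ≤ᵇ n) ∧ ((v ≤ᵇ M) ∧ xorSum B (λ t → (n ∸ progression v ≡ᵇ a * ℓ + m * t) ∧ boundedParts ℓ v t)))
      ≡⟨ xorSum-cong B (λ v _ → trans (cong ((progression v ≤ᵇ n) ∧_) (∧-distribˡ-xorSum B (v ≤ᵇ M) _))
                                      (∧-distribˡ-xorSum B (progression v ≤ᵇ n) _)) ⟩
    xorSum B (λ v → xorSum B (largestSplit ℓ M n v))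
      ≡⟨ sym (boundedParts≡largestSplit ℓ M n B n<B) ⟩
    xorSum B (λ t → (n ≡ᵇ a * suc ℓ + m * t) ∧ boundedParts (suc ℓ) M t) ∎
    where
    open ≡-Reasoning
    weight : ℕ → Bool
    weight q = (q ≤ᵇ progression M) ∧ restrictedParts ok? ℓ q (n ∸ q)

boundedParts-suc : ∀ ℓ M t →
  boundedParts (suc ℓ) (suc M) t ≡ boundedParts (suc ℓ) M t ⊕ shift (suc M) (boundedParts ℓ (suc M)) t
boundedParts-suc ℓ M t = begin
  xorSum (suc t) (λ v → (v ≤ᵇ suc M) ∧ boundedParts ℓ v (t ∸ v))
    ≡⟨ xorSum-cong (suc t) (λ v _ → trans (cong (_∧ boundedParts ℓ v (t ∸ v)) (≤ᵇ-suc v M))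
                                          (∧-distribʳ-xor (boundedParts ℓ v (t ∸ v)) (v ≤ᵇ M) (v ≡ᵇ suc M))) ⟩
  xorSum (suc t) (λ v → ((v ≤ᵇ M) ∧ boundedParts ℓ v (t ∸ v)) ⊕ ((v ≡ᵇ suc M) ∧ boundedParts ℓ v (t ∸ v)))
    ≡⟨ xorSum-⊕ (suc t) (λ v → (v ≤ᵇ M) ∧ boundedParts ℓ v (t ∸ v)) (λ v → (v ≡ᵇ suc M) ∧ boundedParts ℓ v (t ∸ v)) ⟩
  boundedParts (suc ℓ) M t ⊕ xorSum (suc t) (λ v → (v ≡ᵇ suc M) ∧ boundedParts ℓ v (t ∸ v))
    ≡⟨ cong (boundedParts (suc ℓ) M t ⊕_) (xorSum-indicator (suc t) (suc M) (λ v → boundedParts ℓ v (t ∸ v))) ⟩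
  boundedParts (suc ℓ) M t ⊕ shift (suc M) (boundedParts ℓ (suc M)) t ∎
  where open ≡-Reasoning

boundedParts-zero : ∀ ℓ t → boundedParts ℓ 0 t ≡ (t ≡ᵇ 0)
boundedParts-zero zero    t = refl
boundedParts-zero (suc ℓ) t =
  trans (cong₂ _⊕_ (boundedParts-zero ℓ t) (xorSum-false t (λ _ _ → refl))) (xor-identityʳ (t ≡ᵇ 0))

-- distinctExactly n ℓ: the mod-2 series of partitions into exactly ℓ distinct parts, each ≤ n.
distinctExactly : ℕ → ℕ → ℕ → Bool
distinctExactly zero    zero    x = x ≡ᵇ 0
distinctExactly zero    (suc ℓ) x = false
distinctExactly (suc n) zero    x = distinctExactly n zero x
distinctExactly (suc n) (suc ℓ) x = distinctExactly n (suc ℓ) x ⊕ shift (suc n) (distinctExactly n ℓ) x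

distinctExactly-tooMany : ∀ n ℓ x → n < ℓ → distinctExactly n ℓ x ≡ false
distinctExactly-tooMany zero    (suc ℓ) x _         = refl
distinctExactly-tooMany (suc n) (suc ℓ) x (s≤s n<ℓ) =
  cong₂ _⊕_ (distinctExactly-tooMany n (suc ℓ) x (m≤n⇒m≤1+n n<ℓ))
            (trans (shift-cong (suc n) (λ y → distinctExactly-tooMany n ℓ y n<ℓ) x) (∧-zeroʳ _))

distinctParts≡xorSum-distinctExactly : ∀ n x B → n < B → distinctParts 0 n x ≡ xorSum B (λ ℓ → distinctExactly n ℓ x)
distinctParts≡xorSum-distinctExactly zero    x (suc B) _ =
  sym (trans (cong ((x ≡ᵇ 0) ⊕_) (xorSum-false B (λ _ _ → refl))) (xor-identityʳ (x ≡ᵇ 0)))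
distinctParts≡xorSum-distinctExactly (suc n) x (suc B) (s≤s n<B) = begin
  distinctParts 0 n x ⊕ shift (suc n) (distinctParts 0 n) x
    ≡⟨ cong₂ _⊕_ (distinctParts≡xorSum-distinctExactly n x (suc B) (m≤n⇒m≤1+n n<B))
                 (trans (shift-cong (suc n) (λ y → distinctParts≡xorSum-distinctExactly n y B n<B) x)
                        (shift-xorSum (suc n) B (distinctExactly n) x)) ⟩
  (distinctExactly n 0 x ⊕ xorSum B (λ ℓ → distinctExactly n (suc ℓ) x)) ⊕ xorSum B (λ ℓ → shift (suc n) (distinctExactly n ℓ) x)
    ≡⟨ xor-assoc (distinctExactly n 0 x) _ _ ⟩
  distinctExactly n 0 x ⊕ (xorSum B (λ ℓ → distinctExactly n (suc ℓ) x) ⊕ xorSum B (λ ℓ → shift (suc n) (distinctExactly n ℓ) x))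
    ≡⟨ cong (distinctExactly n 0 x ⊕_) (sym (xorSum-⊕ B (λ ℓ → distinctExactly n (suc ℓ) x) (λ ℓ → shift (suc n) (distinctExactly n ℓ) x))) ⟩
  xorSum (suc B) (λ ℓ → distinctExactly (suc n) ℓ x) ∎
  where open ≡-Reasoning

-- Subtracting the staircase ℓ, ℓ − 1, …, 1 from ℓ distinct parts ≤ n leaves at most ℓ parts ≤ n − ℓ.
distinctExactly-staircase : ∀ n ℓ x → ℓ ≤ n → distinctExactly n ℓ x ≡ shift (triangular ℓ) (boundedParts ℓ (n ∸ ℓ)) x
distinctExactly-staircase zero    zero    x _ = refl
distinctExactly-staircase (suc n) zero    x _ = distinctExactly-staircase n zero x z≤n
distinctExactly-staircase (suc n) (suc ℓ) x (s≤s ℓ≤n) with m≤n⇒m<n∨m≡n ℓ≤n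
... | inj₁ ℓ<n = begin
  distinctExactly n (suc ℓ) x ⊕ shift (suc n) (distinctExactly n ℓ) x
    ≡⟨ cong₂ _⊕_ (distinctExactly-staircase n (suc ℓ) x ℓ<n) largestPart ⟩
  shift (triangular (suc ℓ)) (boundedParts (suc ℓ) M) x ⊕ shift (triangular (suc ℓ)) (shift (suc M) (boundedParts ℓ (suc M))) x
    ≡⟨ sym (shift-⊕ (triangular (suc ℓ)) (boundedParts (suc ℓ) M) (shift (suc M) (boundedParts ℓ (suc M))) x) ⟩
  shift (triangular (suc ℓ)) (λ t → boundedParts (suc ℓ) M t ⊕ shift (suc M) (boundedParts ℓ (suc M)) t) x
    ≡⟨ shift-cong (triangular (suc ℓ)) (λ t → sym (boundedParts-suc ℓ M t)) x ⟩
  shift (triangular (suc ℓ)) (boundedParts (suc ℓ) (suc M)) x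
    ≡⟨ cong (λ u → shift (triangular (suc ℓ)) (boundedParts (suc ℓ) u) x) 1+M≡n∸ℓ ⟩
  shift (triangular (suc ℓ)) (boundedParts (suc ℓ) (n ∸ ℓ)) x ∎
  where
  open ≡-Reasoning
  open +-*-Solver
  M : ℕ
  M = n ∸ suc ℓ
  1+M≡n∸ℓ : suc M ≡ n ∸ ℓ
  1+M≡n∸ℓ = suc[m∸1+n]≡m∸n ℓ<n
  offset≡ : suc n + triangular ℓ ≡ triangular (suc ℓ) + suc M
  offset≡ = begin
    suc n + triangular ℓ               ≡⟨ cong (λ u → suc u + triangular ℓ) (sym (m+[n∸m]≡n ℓ≤n)) ⟩
    suc (ℓ + (n ∸ ℓ)) + triangular ℓ  ≡⟨ cong (λ u → suc (ℓ + u) + triangular ℓ) (sym 1+M≡n∸ℓ) ⟩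
    suc (ℓ + suc M) + triangular ℓ    ≡⟨ solve 3 (λ l m t → con 1 :+ (l :+ (con 1 :+ m)) :+ t := (con 1 :+ l :+ t) :+ (con 1 :+ m)) refl ℓ M (triangular ℓ) ⟩
    triangular (suc ℓ) + suc M        ∎
  largestPart : shift (suc n) (distinctExactly n ℓ) x ≡ shift (triangular (suc ℓ)) (shift (suc M) (boundedParts ℓ (suc M))) x
  largestPart = begin
    shift (suc n) (distinctExactly n ℓ) x                              ≡⟨ shift-cong (suc n) (λ y → distinctExactly-staircase n ℓ y ℓ≤n) x ⟩
    shift (suc n) (shift (triangular ℓ) (boundedParts ℓ (n ∸ ℓ))) x    ≡⟨ shift-shift (suc n) (triangular ℓ) (boundedParts ℓ (n ∸ ℓ)) x ⟩
    shift (suc n + triangular ℓ) (boundedParts ℓ (n ∸ ℓ)) x            ≡⟨ cong₂ (λ k u → shift k (boundedParts ℓ u) x) offset≡ (sym 1+M≡n∸ℓ) ⟩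
    shift (triangular (suc ℓ) + suc M) (boundedParts ℓ (suc M)) x      ≡⟨ sym (shift-shift (triangular (suc ℓ)) (suc M) (boundedParts ℓ (suc M)) x) ⟩
    shift (triangular (suc ℓ)) (shift (suc M) (boundedParts ℓ (suc M))) x ∎
... | inj₂ refl = begin
  distinctExactly ℓ (suc ℓ) x ⊕ shift (suc ℓ) (distinctExactly ℓ ℓ) x
    ≡⟨ cong₂ _⊕_ (distinctExactly-tooMany ℓ (suc ℓ) x ≤-refl)
                 (trans (shift-cong (suc ℓ) (λ y → distinctExactly-staircase ℓ ℓ y ≤-refl) x) (shift-shift (suc ℓ) (triangular ℓ) (boundedParts ℓ (ℓ ∸ ℓ)) x)) ⟩
  shift (triangular (suc ℓ)) (boundedParts ℓ (ℓ ∸ ℓ)) x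
    ≡⟨ shift-cong (triangular (suc ℓ)) (λ t → trans (cong (λ u → boundedParts ℓ u t) (n∸n≡0 ℓ))
                                                   (trans (boundedParts-zero ℓ t) (sym (trans (cong (λ u → boundedParts (suc ℓ) u t) (n∸n≡0 ℓ)) (boundedParts-zero (suc ℓ) t))))) x ⟩
  shift (triangular (suc ℓ)) (boundedParts (suc ℓ) (ℓ ∸ ℓ)) x ∎
  where open ≡-Reasoning

distinctParts-staircase : ∀ K B → K < B →
  distinctParts 0 K K ≡ xorSum B (λ ℓ → (triangular ℓ ≤ᵇ K) ∧ boundedParts ℓ (K ∸ triangular ℓ) (K ∸ triangular ℓ))
distinctParts-staircase K B K<B = trans (distinctParts≡xorSum-distinctExactly K K B K<B) (xorSum-cong B (λ ℓ _ → exactly ℓ))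
  where
  ℓ≤triangular : ∀ ℓ → ℓ ≤ triangular ℓ
  ℓ≤triangular zero    = z≤n
  ℓ≤triangular (suc ℓ) = m≤m+n (suc ℓ) (triangular ℓ)
  exactly : ∀ ℓ → distinctExactly K ℓ K ≡ (triangular ℓ ≤ᵇ K) ∧ boundedParts ℓ (K ∸ triangular ℓ) (K ∸ triangular ℓ)
  exactly ℓ with ℓ ≤? K
  ... | yes ℓ≤K = trans (distinctExactly-staircase K ℓ K ℓ≤K)
                        (cong ((triangular ℓ ≤ᵇ K) ∧_) (boundedParts-bound ℓ (K ∸ triangular ℓ) (∸-monoʳ-≤ K (ℓ≤triangular ℓ)) ≤-refl))
  ... | no  ℓ≰K = trans (distinctExactly-tooMany K ℓ K (≰⇒> ℓ≰K))
                        (sym (cong (_∧ boundedParts ℓ (K ∸ triangular ℓ) (K ∸ triangular ℓ)) (≤ᵇ-false (λ Tℓ≤K → ℓ≰K (≤-trans (ℓ≤triangular ℓ) Tℓ≤K)))))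

-- Copartitions

sum-replicate : ∀ k x → sum (replicate k x) ≡ k * x
sum-replicate zero    x = refl
sum-replicate (suc k) x = cong (λ s → x + s) (sum-replicate k x)

-- The size of the copartition (γ , ρ , γ) when γ has ℓ parts of total s.
diagonalSize : ℕ → ℕ → ℕ → ℕ
diagonalSize m ℓ s = s + ℓ * (m * ℓ) + s

odd-cp≡diagonal : ∀ a m n → odd (cp a a m n) ≡
  xorSum (suc n) (λ i → xorList (λ γ → diagonalSize m (length γ) (sum γ) ≡ᵇ n) (filter (allPartsOk? a m) (partitions i)))
odd-cp≡diagonal a m n = begin
  odd (cp a a m n)
    ≡⟨ odd-length-filter (λ c → size c ≟ n) (concatMap (λ i → concatMap (pairs i) (upTo (suc n))) (upTo (suc n))) ⟩
  xorList sized (concatMap (λ i → concatMap (pairs i) (upTo (suc n))) (upTo (suc n)))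
    ≡⟨ xorList-concatMap sized (λ i → concatMap (pairs i) (upTo (suc n))) (upTo (suc n)) ⟩
  xorList (λ i → xorList sized (concatMap (pairs i) (upTo (suc n)))) (upTo (suc n))
    ≡⟨ xorList-cong (upTo (suc n)) (λ i → trans (xorList-concatMap sized (pairs i) (upTo (suc n)))
         (xorList-cong (upTo (suc n)) (λ j → trans (xorList-concatMap sized (λ γ → map (mk γ) (G j)) (G i))
                                                  (xorList-cong (G i) (λ γ → xorList-map sized (mk γ) (G j)))))) ⟩
  xorList (λ i → xorList (λ j → xorList (λ γ → xorList (weight γ) (G j)) (G i)) (upTo (suc n))) (upTo (suc n))
    ≡⟨ xorList-cong (upTo (suc n)) (λ i → xorList-swap (λ j γ → xorList (weight γ) (G j)) (upTo (suc n)) (G i)) ⟩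
  xorList (λ i → xorList (λ γ → xorList (λ j → xorList (weight γ) (G j)) (upTo (suc n))) (G i)) (upTo (suc n))
    ≡⟨ xorList-cong (upTo (suc n)) (λ i → xorList-cong (G i) (λ γ → sym (xorList-concatMap (weight γ) G (upTo (suc n))))) ⟩
  xorList (λ i → xorList (λ γ → xorList (weight γ) allγ) (G i)) (upTo (suc n))
    ≡⟨ sym (xorList-concatMap (λ γ → xorList (weight γ) allγ) G (upTo (suc n))) ⟩
  xorList (λ γ → xorList (weight γ) allγ) allγ
    ≡⟨ xorList-symmetric weight weight-sym allγ ⟩
  xorList (λ γ → weight γ γ) allγ
    ≡⟨ trans (xorList-concatMap (λ γ → weight γ γ) G (upTo (suc n))) (xorList-upTo (λ i → xorList (λ γ → weight γ γ) (G i)) (suc n)) ⟩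
  xorSum (suc n) (λ i → xorList (λ γ → weight γ γ) (G i))
    ≡⟨ xorSum-cong (suc n) (λ i _ → xorList-cong (G i) (λ γ →
         cong (λ u → sum γ + u + sum γ ≡ᵇ n) (sum-replicate (length γ) (m * length γ)))) ⟩
  xorSum (suc n) (λ i → xorList (λ γ → diagonalSize m (length γ) (sum γ) ≡ᵇ n) (G i)) ∎
  where
  open ≡-Reasoning
  open +-*-Solver
  G : ℕ → List (List ℕ)
  G i = filter (allPartsOk? a m) (partitions i)
  allγ : List (List ℕ)
  allγ = concatMap G (upTo (suc n))
  mk : List ℕ → List ℕ → Copartition
  mk γ σ = (γ , replicate (length σ) (m * length γ) , σ)
  pairs : ℕ → ℕ → List Copartition
  pairs i j = concatMap (λ γ → map (mk γ) (G j)) (G i)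
  sized : Copartition → Bool
  sized c = size c ≡ᵇ n
  weight : List ℕ → List ℕ → Bool
  weight γ σ = sized (mk γ σ)
  weight-sym : ∀ γ σ → weight γ σ ≡ weight σ γ
  weight-sym γ σ = cong (_≡ᵇ n) (begin
    sum γ + sum (replicate (length σ) (m * length γ)) + sum σ
      ≡⟨ cong (λ u → sum γ + u + sum σ) (sum-replicate (length σ) (m * length γ)) ⟩
    sum γ + length σ * (m * length γ) + sum σ
      ≡⟨ solve 5 (λ g s ls lg m → g :+ ls :* (m :* lg) :+ s := s :+ lg :* (m :* ls) :+ g) refl (sum γ) (sum σ) (length σ) (length γ) m ⟩
    sum σ + length γ * (m * length σ) + sum γ
      ≡⟨ cong (λ u → sum σ + u + sum γ) (sym (sum-replicate (length γ) (m * length σ))) ⟩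
    sum σ + sum (replicate (length γ) (m * length σ)) + sum γ ∎)

triangular-double : ∀ ℓ → triangular ℓ + triangular ℓ ≡ ℓ + ℓ * ℓ
triangular-double zero    = refl
triangular-double (suc ℓ) = begin
  suc ℓ + triangular ℓ + (suc ℓ + triangular ℓ)  ≡⟨ solve 2 (λ l t → (con 1 :+ l) :+ t :+ ((con 1 :+ l) :+ t) := con 2 :* (con 1 :+ l) :+ (t :+ t)) refl ℓ (triangular ℓ) ⟩
  2 * suc ℓ + (triangular ℓ + triangular ℓ)      ≡⟨ cong (λ u → 2 * suc ℓ + u) (triangular-double ℓ) ⟩
  2 * suc ℓ + (ℓ + ℓ * ℓ)                        ≡⟨ solve 1 (λ l → con 2 :* (con 1 :+ l) :+ (l :+ l :* l) := (con 1 :+ l) :+ (con 1 :+ l) :* (con 1 :+ l)) refl ℓ ⟩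
  suc ℓ + suc ℓ * suc ℓ                          ∎
  where
  open ≡-Reasoning
  open +-*-Solver

module Copartitions (a : ℕ) .{{a≢0 : NonZero a}} where

  m 2m : ℕ
  m  = 2 * a
  2m = 2 * m

  instance
    m≢0 : NonZero m
    m≢0 = m*n≢0 2 a
    2m≢0 : NonZero 2m
    2m≢0 = m*n≢0 2 m

  open Progression a m

  diagonalSize-progression : ∀ ℓ t → diagonalSize m ℓ (a * ℓ + m * t) ≡ 2m * (triangular ℓ + t)
  diagonalSize-progression ℓ t = begin
    (a * ℓ + m * t) + ℓ * (m * ℓ) + (a * ℓ + m * t)
      ≡⟨ solve 3 (λ a l t → (a :* l :+ (con 2 :* a) :* t) :+ l :* ((con 2 :* a) :* l) :+ (a :* l :+ (con 2 :* a) :* t)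
                          := (con 2 :* a) :* (l :+ l :* l) :+ con 2 :* (con 2 :* a) :* t) refl a ℓ t ⟩
    m * (ℓ + ℓ * ℓ) + 2 * m * t
      ≡⟨ cong (λ u → m * u + 2 * m * t) (sym (triangular-double ℓ)) ⟩
    m * (triangular ℓ + triangular ℓ) + 2 * m * t
      ≡⟨ solve 3 (λ m x t → m :* (x :+ x) :+ con 2 :* m :* t := con 2 :* m :* (x :+ t)) refl m (triangular ℓ) t ⟩
    2m * (triangular ℓ + t) ∎
    where
    open ≡-Reasoning
    open +-*-Solver

  cp-parity : ∀ n → odd (cp a a m n) ≡
    xorSum (suc n) (λ ℓ → xorSum (suc n) (λ t → (2m * (triangular ℓ + t) ≡ᵇ n) ∧ boundedParts ℓ t t))
  cp-parity n = begin
    odd (cp a a m n)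
      ≡⟨ odd-cp≡diagonal a m n ⟩
    xorSum N (λ i → xorList (λ γ → h (length γ) (sum γ)) (filter (allPartsOk? a m) (partitions i)))
      ≡⟨ xorSum-cong N (λ i i<N → xorList-partsLe ok? i i ≤-refl i h N i<N) ⟩
    xorSum N (λ i → xorSum N (λ ℓ → h ℓ i ∧ restrictedParts ok? ℓ i i))
      ≡⟨ xorSum-cong N (λ i i<N → xorSum-cong N (λ ℓ _ → cong (h ℓ i ∧_)
           (trans (restrictedParts-bound ok? ℓ i ≤-refl (<⇒≤ (v<progression i))) (restrictedParts-progression ℓ i i N i<N)))) ⟩
    xorSum N (λ i → xorSum N (λ ℓ → h ℓ i ∧ xorSum N (λ t → (i ≡ᵇ a * ℓ + m * t) ∧ boundedParts ℓ i t)))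
      ≡⟨ xorSum-cong N (λ i _ → xorSum-cong N (λ ℓ _ → trans (∧-distribˡ-xorSum N (h ℓ i) (λ t → (i ≡ᵇ a * ℓ + m * t) ∧ boundedParts ℓ i t))
           (xorSum-cong N (λ t _ → ∧.x∙yz≈y∙xz (h ℓ i) (i ≡ᵇ a * ℓ + m * t) (boundedParts ℓ i t))))) ⟩
    xorSum N (λ i → xorSum N (λ ℓ → xorSum N (λ t → (i ≡ᵇ a * ℓ + m * t) ∧ (h ℓ i ∧ boundedParts ℓ i t))))
      ≡⟨ xorSum-swap N N (λ i ℓ → xorSum N (λ t → (i ≡ᵇ a * ℓ + m * t) ∧ (h ℓ i ∧ boundedParts ℓ i t))) ⟩
    xorSum N (λ ℓ → xorSum N (λ i → xorSum N (λ t → (i ≡ᵇ a * ℓ + m * t) ∧ (h ℓ i ∧ boundedParts ℓ i t))))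
      ≡⟨ xorSum-cong N (λ ℓ _ → xorSum-swap N N (λ i t → (i ≡ᵇ a * ℓ + m * t) ∧ (h ℓ i ∧ boundedParts ℓ i t))) ⟩
    xorSum N (λ ℓ → xorSum N (λ t → xorSum N (λ i → (i ≡ᵇ a * ℓ + m * t) ∧ (h ℓ i ∧ boundedParts ℓ i t))))
      ≡⟨ xorSum-cong N (λ ℓ _ → xorSum-cong N (λ t _ → trans (xorSum-indicator N (a * ℓ + m * t) (λ i → h ℓ i ∧ boundedParts ℓ i t))
                                                             (sizeOnly ℓ t))) ⟩
    xorSum N (λ ℓ → xorSum N (λ t → (2m * (triangular ℓ + t) ≡ᵇ n) ∧ boundedParts ℓ t t)) ∎
    where
    open ≡-Reasoning
    N : ℕ
    N = suc n
    h : ℕ → ℕ → Bool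
    h ℓ s = diagonalSize m ℓ s ≡ᵇ n
    sizeOnly : ∀ ℓ t → let c = a * ℓ + m * t in
      (c <ᵇ N) ∧ (h ℓ c ∧ boundedParts ℓ c t) ≡ (2m * (triangular ℓ + t) ≡ᵇ n) ∧ boundedParts ℓ t t
    sizeOnly ℓ t = trans (cong (λ b → (c <ᵇ N) ∧ b) (cong₂ _∧_ (cong (_≡ᵇ n) (diagonalSize-progression ℓ t))
                                                             (boundedParts-bound ℓ t t≤c ≤-refl)))
                         (dropBound (c ≤? n))
      where
      c : ℕ
      c = a * ℓ + m * t
      t≤c : t ≤ c
      t≤c = ≤-trans (m≤n*m t m) (m≤n+m (m * t) (a * ℓ))
      c≤size : c ≤ 2m * (triangular ℓ + t)
      c≤size = subst (c ≤_) (diagonalSize-progression ℓ t) (≤-trans (m≤m+n c _) (m≤m+n (c + ℓ * (m * ℓ)) c))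
      dropBound : Dec (c ≤ n) → (c <ᵇ N) ∧ ((2m * (triangular ℓ + t) ≡ᵇ n) ∧ boundedParts ℓ t t)
                                ≡ (2m * (triangular ℓ + t) ≡ᵇ n) ∧ boundedParts ℓ t t
      dropBound (yes c≤n) = cong (_∧ ((2m * (triangular ℓ + t) ≡ᵇ n) ∧ boundedParts ℓ t t)) (≤ᵇ-true (s≤s c≤n))
      dropBound (no  c≰n) rewrite ≡ᵇ-false (λ size≡n → c≰n (subst (c ≤_) size≡n c≤size)) = ∧-zeroʳ (c <ᵇ N)

  cp-parity-multiple : ∀ K → odd (cp a a m (2m * K)) ≡ pentagonalSeries K K
  cp-parity-multiple K = begin
    odd (cp a a m n)
      ≡⟨ cp-parity n ⟩
    xorSum N (λ ℓ → xorSum N (λ t → (2m * (triangular ℓ + t) ≡ᵇ n) ∧ boundedParts ℓ t t))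
      ≡⟨ xorSum-cong N (λ ℓ _ → sizeK ℓ) ⟩
    xorSum N (λ ℓ → (triangular ℓ ≤ᵇ K) ∧ boundedParts ℓ (K ∸ triangular ℓ) (K ∸ triangular ℓ))
      ≡⟨ sym (distinctParts-staircase K N (s≤s K≤n)) ⟩
    distinctParts 0 K K
      ≡⟨ distinctParts≡pentagonalSeries K K ≤-refl ⟩
    pentagonalSeries K K ∎
    where
    open ≡-Reasoning
    n N : ℕ
    n = 2m * K
    N = suc n
    K≤n : K ≤ n
    K≤n = m≤n*m K 2m
    sizeK : ∀ ℓ → xorSum N (λ t → (2m * (triangular ℓ + t) ≡ᵇ n) ∧ boundedParts ℓ t t)
                ≡ (triangular ℓ ≤ᵇ K) ∧ boundedParts ℓ (K ∸ triangular ℓ) (K ∸ triangular ℓ)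
    sizeK ℓ = begin
      xorSum N (λ t → (2m * (Tℓ + t) ≡ᵇ n) ∧ boundedParts ℓ t t)
        ≡⟨ xorSum-cong N (λ t _ → trans (cong (_∧ boundedParts ℓ t t) (does-⇔ (size⇔ t) (_ ≟ _) (Tℓ ≤? K ×-dec t ≟ c)))
                                        (∧-assoc (Tℓ ≤ᵇ K) (t ≡ᵇ c) _)) ⟩
      xorSum N (λ t → (Tℓ ≤ᵇ K) ∧ ((t ≡ᵇ c) ∧ boundedParts ℓ t t))
        ≡⟨ sym (∧-distribˡ-xorSum N (Tℓ ≤ᵇ K) (λ t → (t ≡ᵇ c) ∧ boundedParts ℓ t t)) ⟩
      (Tℓ ≤ᵇ K) ∧ xorSum N (λ t → (t ≡ᵇ c) ∧ boundedParts ℓ t t)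
        ≡⟨ cong ((Tℓ ≤ᵇ K) ∧_) (xorSum-indicator N c (λ t → boundedParts ℓ t t)) ⟩
      (Tℓ ≤ᵇ K) ∧ ((c <ᵇ N) ∧ boundedParts ℓ c c)
        ≡⟨ cong (λ b → (Tℓ ≤ᵇ K) ∧ (b ∧ boundedParts ℓ c c)) (≤ᵇ-true (s≤s (≤-trans (m∸n≤m K Tℓ) K≤n))) ⟩
      (Tℓ ≤ᵇ K) ∧ boundedParts ℓ c c ∎
      where
      Tℓ c : ℕ
      Tℓ = triangular ℓ
      c = K ∸ Tℓ
      size⇔ : ∀ t → 2m * (Tℓ + t) ≡ n ⇔ (Tℓ ≤ K × t ≡ c)
      size⇔ t = mk⇔ (λ e → let Tℓ+t≡K = *-cancelˡ-≡ (Tℓ + t) K 2m e in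
                           subst (Tℓ ≤_) Tℓ+t≡K (m≤m+n Tℓ t) , trans (sym (m+n∸m≡n Tℓ t)) (cong (_∸ Tℓ) Tℓ+t≡K))
                    (λ (Tℓ≤K , t≡c) → cong (2m *_) (trans (cong (λ u → Tℓ + u) t≡c) (m+[n∸m]≡n Tℓ≤K)))

  cp-parity-nonmultiple : ∀ n → (∀ K → n ≢ 2m * K) → odd (cp a a m n) ≡ false
  cp-parity-nonmultiple n ¬mult = trans (cp-parity n) (xorSum-false (suc n) (λ ℓ _ → xorSum-false (suc n) (λ t _ →
    cong (_∧ boundedParts ℓ t t) (≡ᵇ-false (λ e → ¬mult (triangular ℓ + t) (sym e))))))

  odd-cp⇔pentagonal : ∀ n → odd (cp a a m n) ≡ true ⇔ ∃ λ K → n ≡ 2m * K × IsPentagonal K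
  odd-cp⇔pentagonal n = mk⇔ to from
    where
    to : odd (cp a a m n) ≡ true → ∃ λ K → n ≡ 2m * K × IsPentagonal K
    to odd≡true with 2m ∣? n
    ... | yes (divides K n≡K*2m) = K , n≡2mK , pentagonalSeries⇒IsPentagonal K K
            (trans (sym (cp-parity-multiple K)) (trans (cong (odd ∘ cp a a m) (sym n≡2mK)) odd≡true))
      where
      n≡2mK : n ≡ 2m * K
      n≡2mK = trans n≡K*2m (*-comm K 2m)
    ... | no ¬2m∣n = ⊥-elim (false≢true (trans (sym (cp-parity-nonmultiple n λ K n≡2mK → ¬2m∣n (divides K (trans n≡2mK (*-comm 2m K))))) odd≡true))
      where
      false≢true : false ≢ true
      false≢true ()
    from : (∃ λ K → n ≡ 2m * K × IsPentagonal K) → odd (cp a a m n) ≡ true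
    from (K , refl , pent) = trans (cp-parity-multiple K) (IsPentagonal⇒pentagonalSeries K pent)

2∣⇒odd≡false : ∀ {n} → 2 ∣ n → odd n ≡ false
2∣⇒odd≡false (divides q refl) = odd-double q
  where
  odd-double : ∀ q → odd (q * 2) ≡ false
  odd-double zero    = refl
  odd-double (suc q) = trans (not-involutive (odd (q * 2))) (odd-double q)

odd≡false⇒2∣ : ∀ n → odd n ≡ false → 2 ∣ n
odd≡false⇒2∣ zero          _ = divides 0 refl
odd≡false⇒2∣ (suc (suc n)) e with odd≡false⇒2∣ n (trans (sym (not-involutive (odd n))) e)
... | divides q n≡q*2 = divides (suc q) (cong (λ u → 2 + u) n≡q*2)

odd≡true⇔¬2∣ : ∀ n → odd n ≡ true ⇔ (¬ 2 ∣ n)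
odd≡true⇔¬2∣ n = mk⇔ (λ odd≡true 2∣n → true≢false (trans (sym odd≡true) (2∣⇒odd≡false 2∣n)))
                     (λ ¬2∣n → ¬-not (λ odd≡false → ¬2∣n (odd≡false⇒2∣ n odd≡false)))
  where
  true≢false : true ≢ false
  true≢false ()

module IntegerForm (a : ℕ) .{{a≢0 : NonZero a}} where
  open Copartitions a

  -- 2a z (3z − 1) = 4a ω(z), the values in the statement of the theorem.
  ω-form : ℤ → ℤ
  ω-form z = (+ 2 ℤ.* + a) ℤ.* z ℤ.* (+ 3 ℤ.* z ℤ.- + 1)

  2m*pentagonal⁺ : ∀ j → 2m * pentagonal⁺ j ≡ 2 * a * (suc j * (2 + 3 * j))
  2m*pentagonal⁺ j = begin
    2m * (suc j * suc j + triangular j)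
      ≡⟨ solve 3 (λ a j t → con 2 :* (con 2 :* a) :* ((con 1 :+ j) :* (con 1 :+ j) :+ t)
                        := con 2 :* a :* (con 2 :* ((con 1 :+ j) :* (con 1 :+ j)) :+ (t :+ t))) refl a j (triangular j) ⟩
    2 * a * (2 * (suc j * suc j) + (triangular j + triangular j))
      ≡⟨ cong (λ u → 2 * a * (2 * (suc j * suc j) + u)) (triangular-double j) ⟩
    2 * a * (2 * (suc j * suc j) + (j + j * j))
      ≡⟨ solve 2 (λ a j → con 2 :* a :* (con 2 :* ((con 1 :+ j) :* (con 1 :+ j)) :+ (j :+ j :* j))
                        := con 2 :* a :* ((con 1 :+ j) :* (con 2 :+ con 3 :* j))) refl a j ⟩
    2 * a * (suc j * (2 + 3 * j)) ∎
    where
    open ≡-Reasoning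
    open +-*-Solver

  2m*pentagonal⁻ : ∀ j → 2m * pentagonal⁻ j ≡ 2 * a * (suc j * (4 + 3 * j))
  2m*pentagonal⁻ j = begin
    2m * (suc j * suc j + (suc j + triangular j))
      ≡⟨ solve 3 (λ a j t → con 2 :* (con 2 :* a) :* ((con 1 :+ j) :* (con 1 :+ j) :+ ((con 1 :+ j) :+ t))
                        := con 2 :* a :* (con 2 :* ((con 1 :+ j) :* (con 1 :+ j)) :+ con 2 :* (con 1 :+ j) :+ (t :+ t))) refl a j (triangular j) ⟩
    2 * a * (2 * (suc j * suc j) + 2 * suc j + (triangular j + triangular j))
      ≡⟨ cong (λ u → 2 * a * (2 * (suc j * suc j) + 2 * suc j + u)) (triangular-double j) ⟩
    2 * a * (2 * (suc j * suc j) + 2 * suc j + (j + j * j))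
      ≡⟨ solve 2 (λ a j → con 2 :* a :* (con 2 :* ((con 1 :+ j) :* (con 1 :+ j)) :+ con 2 :* (con 1 :+ j) :+ (j :+ j :* j))
                        := con 2 :* a :* ((con 1 :+ j) :* (con 4 :+ con 3 :* j))) refl a j ⟩
    2 * a * (suc j * (4 + 3 * j)) ∎
    where
    open ≡-Reasoning
    open +-*-Solver

  pos-product : ∀ c j → + (2 * a * (suc j * (c + 3 * j))) ≡ (+ 2 ℤ.* + a) ℤ.* (+ suc j ℤ.* (+ c ℤ.+ + 3 ℤ.* + j))
  pos-product c j =
    trans (ℤₚ.pos-* (2 * a) (suc j * (c + 3 * j)))
          (cong₂ ℤ._*_ (ℤₚ.pos-* 2 a) (trans (ℤₚ.pos-* (suc j) (c + 3 * j))
                                              (cong ((+ suc j) ℤ.*_) (trans (ℤₚ.pos-+ c (3 * j)) (cong (λ z → + c ℤ.+ z) (ℤₚ.pos-* 3 j))))))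

  ω-form-positive : ∀ j → ω-form (+ suc j) ≡ + (2m * pentagonal⁺ j)
  ω-form-positive j = sym (trans (cong +_ (2m*pentagonal⁺ j)) (trans (pos-product 2 j)
    (solve 2 (λ A J → (con (+ 2) :* A) :* ((con (+ 1) :+ J) :* (con (+ 2) :+ con (+ 3) :* J))
                   := (con (+ 2) :* A) :* (con (+ 1) :+ J) :* (con (+ 3) :* (con (+ 1) :+ J) :- con (+ 1))) refl (+ a) (+ j))))
    where open ℤ-Solver

  ω-form-negative : ∀ j → ω-form -[1+ j ] ≡ + (2m * pentagonal⁻ j)
  ω-form-negative j = sym (trans (cong +_ (2m*pentagonal⁻ j)) (trans (pos-product 4 j)
    (solve 2 (λ A J → (con (+ 2) :* A) :* ((con (+ 1) :+ J) :* (con (+ 4) :+ con (+ 3) :* J))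
                   := (con (+ 2) :* A) :* (:- (con (+ 1) :+ J)) :* (con (+ 3) :* (:- (con (+ 1) :+ J)) :- con (+ 1))) refl (+ a) (+ j))))
    where open ℤ-Solver

  ω-form-zero : ω-form (+ 0) ≡ + 0
  ω-form-zero = trans (cong (ℤ._* (+ 3 ℤ.* + 0 ℤ.- + 1)) (ℤₚ.*-zeroʳ (+ 2 ℤ.* + a))) (ℤₚ.*-zeroˡ (+ 3 ℤ.* + 0 ℤ.- + 1))

  ω-form⇔pentagonal : ∀ k → (∃ λ z → + k ≡ ω-form z) ⇔ (∃ λ K → k ≡ 2m * K × IsPentagonal K)
  ω-form⇔pentagonal k = mk⇔ to from
    where
    to : (∃ λ z → + k ≡ ω-form z) → ∃ λ K → k ≡ 2m * K × IsPentagonal K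
    to (+ zero   , k≡ω) = 0 , trans (ℤₚ.+-injective (trans k≡ω ω-form-zero)) (sym (*-zeroʳ 2m)) , inj₁ refl
    to (+ suc j  , k≡ω) = pentagonal⁺ j , ℤₚ.+-injective (trans k≡ω (ω-form-positive j)) , inj₂ (j , inj₁ refl)
    to (-[1+ j ] , k≡ω) = pentagonal⁻ j , ℤₚ.+-injective (trans k≡ω (ω-form-negative j)) , inj₂ (j , inj₂ refl)
    from : (∃ λ K → k ≡ 2m * K × IsPentagonal K) → ∃ λ z → + k ≡ ω-form z
    from (K , refl , inj₁ refl)            = + 0 , trans (cong +_ (*-zeroʳ 2m)) (sym ω-form-zero)
    from (K , refl , inj₂ (j , inj₁ refl)) = + suc j , sym (ω-form-positive j)
    from (K , refl , inj₂ (j , inj₂ refl)) = -[1+ j ] , sym (ω-form-negative j)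

  ¬2∣cp⇔ω-form : ∀ k → (¬ 2 ∣ cp a a m k) ⇔ (∃ λ z → + k ≡ ω-form z)
  ¬2∣cp⇔ω-form k = ⇔.trans (⇔.sym (odd≡true⇔¬2∣ (cp a a m k))) (⇔.trans (odd-cp⇔pentagonal k) (⇔.sym (ω-form⇔pentagonal k)))

-- Density

fromBool : Bool → ℕ
fromBool true  = 1
fromBool false = 0

countTrue : ℕ → (ℕ → Bool) → ℕ
countTrue zero    f = 0
countTrue (suc n) f = fromBool (f 0) + countTrue n (f ∘ suc)

countTrue-sucʳ : ∀ n (f : ℕ → Bool) → countTrue (suc n) f ≡ countTrue n f + fromBool (f n)
countTrue-sucʳ zero    f = +-comm (fromBool (f 0)) 0
countTrue-sucʳ (suc n) f = trans (cong (λ c → fromBool (f 0) + c) (countTrue-sucʳ n (f ∘ suc)))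
                                 (sym (+-assoc (fromBool (f 0)) _ _))

countTrue-≤ : ∀ n (f : ℕ → Bool) → countTrue n f ≤ n
countTrue-≤ zero    f = z≤n
countTrue-≤ (suc n) f with f 0
... | true  = s≤s (countTrue-≤ n (f ∘ suc))
... | false = m≤n⇒m≤1+n (countTrue-≤ n (f ∘ suc))

countTrue-not : ∀ n (f : ℕ → Bool) → countTrue n (not ∘ f) + countTrue n f ≡ n
countTrue-not zero    f = refl
countTrue-not (suc n) f with f 0
... | true  = trans (+-suc (countTrue n (not ∘ f ∘ suc)) _) (cong suc (countTrue-not n (f ∘ suc)))
... | false = cong suc (countTrue-not n (f ∘ suc))

countTrue-mono : ∀ n {f g : ℕ → Bool} → (∀ i → i < n → f i ≡ true → g i ≡ true) → countTrue n f ≤ countTrue n g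
countTrue-mono zero    f⇒g = z≤n
countTrue-mono (suc n) {f} {g} f⇒g with f 0 in f0 | g 0 in g0
... | false | false = countTrue-mono n (λ i i<n → f⇒g (suc i) (s<s i<n))
... | false | true  = m≤n⇒m≤1+n (countTrue-mono n (λ i i<n → f⇒g (suc i) (s<s i<n)))
... | true  | true  = s≤s (countTrue-mono n (λ i i<n → f⇒g (suc i) (s<s i<n)))
... | true  | false with () ← trans (sym (f⇒g 0 z<s f0)) g0

countTrue-mono-< : ∀ n {f g : ℕ → Bool} → (∀ i → i < n → f i ≡ true → g i ≡ true) →
                   ∀ j → j < n → f j ≡ false → g j ≡ true → countTrue n f < countTrue n g
countTrue-mono-< (suc n) {f} {g} f⇒g zero _ f0 g0 rewrite f0 | g0 = s≤s (countTrue-mono n (λ i i<n → f⇒g (suc i) (s<s i<n)))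
countTrue-mono-< (suc n) {f} {g} f⇒g (suc j) (s≤s j<n) fj gj with f 0 in f0 | g 0 in g0
... | false | false = countTrue-mono-< n (λ i i<n → f⇒g (suc i) (s<s i<n)) j j<n fj gj
... | false | true  = m<n⇒m<1+n (countTrue-mono-< n (λ i i<n → f⇒g (suc i) (s<s i<n)) j j<n fj gj)
... | true  | true  = s<s (countTrue-mono-< n (λ i i<n → f⇒g (suc i) (s<s i<n)) j j<n fj gj)
... | true  | false with () ← trans (sym (f⇒g 0 z<s f0)) g0

length-filter-applyUpTo : ∀ {P : ℕ → Set} (P? : ∀ x → Dec (P x)) (g : ℕ → ℕ) n →
                          length (filter P? (applyUpTo g n)) ≡ countTrue n (λ i → does (P? (g i)))
length-filter-applyUpTo P? g zero = refl
length-filter-applyUpTo P? g (suc n) with P? (g 0)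
... | yes _ = cong suc (length-filter-applyUpTo P? (g ∘ suc) n)
... | no  _ = length-filter-applyUpTo P? (g ∘ suc) n

<-square-reflect : ∀ {j s} → j * j < s * s → j < s
<-square-reflect {j} {s} j²<s² with j <? s
... | yes j<s = j<s
... | no  j≮s = ⊥-elim (<⇒≱ j²<s² (*-mono-≤ (≮⇒≥ j≮s) (≮⇒≥ j≮s)))

integerSqrt : ∀ n → ∃ λ s → s * s ≤ n × n < suc s * suc s
integerSqrt zero = 0 , z≤n , s≤s z≤n
integerSqrt (suc n) with integerSqrt n
... | s , s²≤n , n<[1+s]² with suc s * suc s ≤? suc n
...   | yes [1+s]²≤1+n = suc s , [1+s]²≤1+n ,
          subst (_< suc (suc s) * suc (suc s)) (≤-antisym [1+s]²≤1+n n<[1+s]²) (*-mono-< (n<1+n (suc s)) (n<1+n (suc s)))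
...   | no  [1+s]²≰1+n = s , m≤n⇒m≤1+n s²≤n , ≰⇒> [1+s]²≰1+n

countTrue-cong : ∀ n {f g : ℕ → Bool} → (∀ i → f i ≡ g i) → countTrue n f ≡ countTrue n g
countTrue-cong zero    eq = refl
countTrue-cong (suc n) eq = cong₂ (λ b c → fromBool b + c) (eq 0) (countTrue-cong n (eq ∘ suc))

does-2∣? : ∀ x → does (2 ∣? x) ≡ not (odd x)
does-2∣? x with odd x in odd≡
... | true  = dec-false (2 ∣? x) (Equivalence.to (odd≡true⇔¬2∣ x) odd≡)
... | false = dec-true (2 ∣? x) (odd≡false⇒2∣ x odd≡)

module Density (a : ℕ) .{{a≢0 : NonZero a}} where
  open Copartitions a

  oddAt : ℕ → Bool
  oddAt i = odd (cp a a m (suc i))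

  n∸evenCount≡countTrue : ∀ n → n ∸ evenCount a n ≡ countTrue n oddAt
  n∸evenCount≡countTrue n = begin
    n ∸ evenCount a n                                        ≡⟨ cong (n ∸_) evenCount≡ ⟩
    n ∸ countTrue n (not ∘ oddAt)                            ≡⟨ cong (_∸ countTrue n (not ∘ oddAt)) (sym (countTrue-not n oddAt)) ⟩
    countTrue n (not ∘ oddAt) + countTrue n oddAt ∸ countTrue n (not ∘ oddAt) ≡⟨ m+n∸m≡n (countTrue n (not ∘ oddAt)) _ ⟩
    countTrue n oddAt                                        ∎
    where
    open ≡-Reasoning
    evenCount≡ : evenCount a n ≡ countTrue n (not ∘ oddAt)
    evenCount≡ = trans (cong (length ∘ filter (λ k → 2 ∣? cp a a m k)) (map-applyUpTo (λ i → i) suc n))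
                       (trans (length-filter-applyUpTo (λ k → 2 ∣? cp a a m k) suc n)
                              (countTrue-cong n (λ i → does-2∣? (cp a a m (suc i)))))

  -- Each k ≤ n with cp k odd is 2m pentagonal⁺ j or 2m pentagonal⁻ j for some j < s, as (j+1)² ≤ k.
  countTrue-oddAt-≤ : ∀ s n → n < suc s * suc s →
    countTrue n oddAt ≤ countTrue s (λ j → 2m * pentagonal⁺ j ≤ᵇ n) + countTrue s (λ j → 2m * pentagonal⁻ j ≤ᵇ n)
  countTrue-oddAt-≤ s zero    _ = z≤n
  countTrue-oddAt-≤ s (suc n) 1+n<[1+s]² = begin
    countTrue (suc n) oddAt                 ≡⟨ countTrue-sucʳ n oddAt ⟩
    countTrue n oddAt + fromBool (oddAt n)  ≤⟨ +-monoˡ-≤ (fromBool (oddAt n)) (countTrue-oddAt-≤ s n (<-trans (n<1+n n) 1+n<[1+s]²)) ⟩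
    C⁺ n + C⁻ n + fromBool (oddAt n)        ≤⟨ step (oddAt n) refl ⟩
    C⁺ (suc n) + C⁻ (suc n)                 ∎
    where
    open ≤-Reasoning
    g⁺ g⁻ C⁺ C⁻ : ℕ → ℕ
    g⁺ j = 2m * pentagonal⁺ j
    g⁻ j = 2m * pentagonal⁻ j
    C⁺ k = countTrue s (λ j → g⁺ j ≤ᵇ k)
    C⁻ k = countTrue s (λ j → g⁻ j ≤ᵇ k)
    widen : ∀ g j → j < s → (g j ≤ᵇ n) ≡ true → (g j ≤ᵇ suc n) ≡ true
    widen g j _ le = ≤ᵇ-true {g j} (m≤n⇒m≤1+n (≤ᵇ-sound {g j} le))
    newValue : ∀ g j → j < s → g j ≡ suc n → countTrue s (λ i → g i ≤ᵇ n) < countTrue s (λ i → g i ≤ᵇ suc n)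
    newValue g j j<s gj≡ = countTrue-mono-< s (widen g) j j<s (≤ᵇ-false (λ le → 1+n≰n (subst (_≤ n) gj≡ le))) (≤ᵇ-true (≤-reflexive gj≡))
    index<s : ∀ j p → suc j * suc j ≤ p → 2m * p ≡ suc n → j < s
    index<s j p [1+j]²≤p 2mp≡ = ≤-pred (<-square-reflect (≤-<-trans (≤-trans [1+j]²≤p (m≤n*m p 2m))
                                                                    (subst (_< suc s * suc s) (sym 2mp≡) 1+n<[1+s]²)))
    step : ∀ b → oddAt n ≡ b → C⁺ n + C⁻ n + fromBool b ≤ C⁺ (suc n) + C⁻ (suc n)
    step false _ = subst (_≤ C⁺ (suc n) + C⁻ (suc n)) (sym (+-identityʳ _))
                         (+-mono-≤ (countTrue-mono s (widen g⁺)) (countTrue-mono s (widen g⁻)))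
    step true odd≡ with Equivalence.to (odd-cp⇔pentagonal (suc n)) odd≡
    ... | K , 1+n≡2mK , inj₁ K≡0 = ⊥-elim (1+n≢0 (trans 1+n≡2mK (trans (cong (2m *_) K≡0) (*-zeroʳ 2m))))
    ... | K , 1+n≡2mK , inj₂ (j , inj₁ K≡p⁺) = begin
      C⁺ n + C⁻ n + 1           ≡⟨ +-comm _ 1 ⟩
      suc (C⁺ n) + C⁻ n         ≤⟨ +-mono-≤ (newValue g⁺ j (index<s j _ (m≤m+n _ _) 2mp≡) 2mp≡)
                                            (countTrue-mono s (widen g⁻)) ⟩
      C⁺ (suc n) + C⁻ (suc n)   ∎
      where
      2mp≡ : 2m * pentagonal⁺ j ≡ suc n
      2mp≡ = trans (cong (2m *_) (sym K≡p⁺)) (sym 1+n≡2mK)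
    ... | K , 1+n≡2mK , inj₂ (j , inj₂ K≡p⁻) = begin
      C⁺ n + C⁻ n + 1           ≡⟨ trans (+-assoc (C⁺ n) _ 1) (cong (λ c → C⁺ n + c) (+-comm _ 1)) ⟩
      C⁺ n + suc (C⁻ n)         ≤⟨ +-mono-≤ (countTrue-mono s (widen g⁺))
                                            (newValue g⁻ j (index<s j _ (m≤m+n _ _) 2mp≡) 2mp≡) ⟩
      C⁺ (suc n) + C⁻ (suc n)   ∎
      where
      2mp≡ : 2m * pentagonal⁻ j ≡ suc n
      2mp≡ = trans (cong (2m *_) (sym K≡p⁻)) (sym 1+n≡2mK)

  -- There are at most 2 ⌊√n⌋ odd values among cp(1), …, cp(n).
  density : ∀ e → ∃ λ N → ∀ n → N ≤ n → suc e * (n ∸ evenCount a n) < n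
  density e = suc r * suc r , bound
    where
    r : ℕ
    r = suc e + suc e
    bound : ∀ n → suc r * suc r ≤ n → suc e * (n ∸ evenCount a n) < n
    bound n N≤n with integerSqrt n
    ... | s , s²≤n , n<[1+s]² = begin-strict
      suc e * (n ∸ evenCount a n) ≡⟨ cong (suc e *_) (n∸evenCount≡countTrue n) ⟩
      suc e * countTrue n oddAt   ≤⟨ *-monoʳ-≤ (suc e) (≤-trans (countTrue-oddAt-≤ s n n<[1+s]²)
                                                                (+-mono-≤ (countTrue-≤ s _) (countTrue-≤ s _))) ⟩
      suc e * (s + s)             ≡⟨ solve 2 (λ e s → (con 1 :+ e) :* (s :+ s) := ((con 1 :+ e) :+ (con 1 :+ e)) :* s) refl e s ⟩
      r * s                       <⟨ *-monoˡ-< s {{>-nonZero (≤-<-trans z≤n r<s)}} r<s ⟩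
      s * s                       ≤⟨ s²≤n ⟩
      n                           ∎
      where
      open ≤-Reasoning
      open +-*-Solver
      r<s : r < s
      r<s = ≤-pred (<-square-reflect (≤-<-trans N≤n n<[1+s]²))

corollary3p7 : (a : ℕ) → 1 ≤ a → ¬ (2 ∣ a) →
    ((e : ℕ) → ∃ λ N → (n : ℕ) → N ≤ n → suc e * (n ∸ evenCount a n) < n)
    × ((k : ℕ) → (¬ (2 ∣ cp a a (2 * a) k)) ⇔ (∃ λ (z : ℤ) → + k ≡ (+ 2 Data.Integer.* + a) Data.Integer.* z Data.Integer.* (+ 3 Data.Integer.* z Data.Integer.- + 1)))
corollary3p7 (suc a′) _ _ = Density.density (suc a′) , IntegerForm.¬2∣cp⇔ω-form (suc a′)
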